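{- Let $p$ be a Sophie Germain prime with $p\equiv 3 \pmod 4$, and let $k\geq 0$ be an integer. Then the only non-negative integer solutions of the equation $p^x-(2^{k}(2p+1))^y=z^2$ are $(x,y,z)=(0,0,0)$ (for any $p,k$) and $(p,k,x,y,z)=(3,3,4,1,5)$.
   Context: A prime $p$ is called a Sophie Germain prime if $2p+1$ is also prime. -}

module Defs where

open import Data.Nat using (ℕ; _*_; _+_)
open import Data.Nat.Primality using (Prime)
open import Data.Product using (_×_)

SophieGermainPrime : ℕ → Set
SophieGermainPrime p = Prime p × Prime (2 * p + 1)

module Submission where

-- Write q = 2p + 1 and N = 2ᵏq; for x = 0 only the trivial solution exists. If Nʸ ≡ 1 (mod p), that is
-- y = 0 or k = 0, then −1 is a square modulo p, which Euler's criterion forbids for p ≡ 3 (mod 4); parity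
-- forces z to be odd. If Nʸ = 2q, reduction modulo 4 makes x odd, which is impossible modulo 8 when
-- p ≡ 3 (mod 8) and makes −2 a square modulo p when p ≡ 7 (mod 8), contradicting Gauss's 2^((p−1)/2) ≡ 1.
-- Otherwise 4 ∣ Nʸ, so x = 2a and (pᵃ − z)(pᵃ + z) = 2^(ky) qʸ. As q divides only one factor, pᵃ = 2ʲqʸ + 1
-- or pᵃ = 2ʲ + qʸ with j = ky − 2. In the first case (p − 1)/2 divides qʸ, so p = 3, and 3ᵃ ≡ 1 (mod 7)
-- then forces 13 ∣ 2ʲ7ʸ. In the second case p ∣ 2ʲ + 1; this leaves p = 3 and 3ᵃ = 7ʸ + 2, i.e.
-- (k, y, a) = (3, 1, 2), all other possibilities dying modulo 3, 4 or 8.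

module Congruence where

  open import Data.Nat as ℕ using (ℕ; zero; suc; _<_; z≤n; s≤s)
  import Data.Nat.Properties as ℕ
  import Data.Nat.Divisibility as ℕ
  open import Data.Nat.DivMod using (m≡m%n+[m/n]*n)
  open import Data.Nat.Primality using (Prime; euclidsLemma)
  open import Data.Integer using (ℤ; +_; -_; _+_; _-_; _*_; _^_; ∣_∣; 0ℤ; 1ℤ)
  import Data.Integer.Properties as ℤ
  open import Data.Integer.Divisibility.Signed
    using (_∣_; divides; _∣?_; ∣-refl; ∣m∣n⇒∣m+n; ∣m⇒∣m*n; ∣n⇒∣m*n; ∣⇒∣ᵤ; ∣ᵤ⇒∣)
    renaming (∣-trans to ∣ℤ-trans)
  open import Data.Integer.Tactic.RingSolver using (solve-∀)
  open import Data.Empty using (⊥)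
  open import Data.Sum using (_⊎_; inj₁; inj₂)
  open import Function using (_∘_)
  open import Relation.Binary.Bundles using (Setoid)
  open import Relation.Binary.Structures using (IsEquivalence)
  open import Relation.Nullary using (¬_; contradiction)
  open import Relation.Nullary.Decidable using (True; False; toWitness; toWitnessFalse)
  open import Relation.Binary.PropositionalEquality

  infix 4 _≡_mod_

  record _≡_mod_ (a b : ℤ) (n : ℕ) : Set where
    constructor mod-by
    field
      divides-difference : + n ∣ a - b

  open _≡_mod_

  private
    mod-by′ : ∀ {n a b c} → + n ∣ c → c ≡ a - b → a ≡ b mod n
    mod-by′ n∣c refl = mod-by n∣c

  module _ {n : ℕ} where

    ≡-mod-reflexive : ∀ {a b} → a ≡ b → a ≡ b mod n
    ≡-mod-reflexive {a} refl = mod-by (divides 0ℤ (lemma a (+ n)))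
      where
      lemma : ∀ a n → a - a ≡ 0ℤ * n
      lemma = solve-∀

    ≡-mod-refl : ∀ {a} → a ≡ a mod n
    ≡-mod-refl = ≡-mod-reflexive refl

    ≡-mod-sym : ∀ {a b} → a ≡ b mod n → b ≡ a mod n
    ≡-mod-sym {a} {b} (mod-by (divides k a-b≡kn)) =
      mod-by (divides (- k) (trans (lemma a b) (trans (cong -_ a-b≡kn) (ℤ.neg-distribˡ-* k (+ n)))))
      where
      lemma : ∀ a b → b - a ≡ - (a - b)
      lemma = solve-∀

    ≡-mod-trans : ∀ {a b c} → a ≡ b mod n → b ≡ c mod n → a ≡ c mod n
    ≡-mod-trans {a} {b} {c} (mod-by n∣a-b) (mod-by n∣b-c) = mod-by′ (∣m∣n⇒∣m+n n∣a-b n∣b-c) (lemma a b c)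
      where
      lemma : ∀ a b c → (a - b) + (b - c) ≡ a - c
      lemma = solve-∀

    +-cong-mod : ∀ {a b c d} → a ≡ b mod n → c ≡ d mod n → a + c ≡ b + d mod n
    +-cong-mod {a} {b} {c} {d} (mod-by n∣a-b) (mod-by n∣c-d) = mod-by′ (∣m∣n⇒∣m+n n∣a-b n∣c-d) (lemma a b c d)
      where
      lemma : ∀ a b c d → (a - b) + (c - d) ≡ (a + c) - (b + d)
      lemma = solve-∀

    *-cong-mod : ∀ {a b c d} → a ≡ b mod n → c ≡ d mod n → a * c ≡ b * d mod n
    *-cong-mod {a} {b} {c} {d} (mod-by n∣a-b) (mod-by n∣c-d) =
      mod-by′ (∣m∣n⇒∣m+n (∣m⇒∣m*n c n∣a-b) (∣n⇒∣m*n b n∣c-d)) (lemma a b c d)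
      where
      lemma : ∀ a b c d → (a - b) * c + b * (c - d) ≡ a * c - b * d
      lemma = solve-∀

    +-congˡ-mod : ∀ a {b c} → b ≡ c mod n → a + b ≡ a + c mod n
    +-congˡ-mod a = +-cong-mod (≡-mod-refl {a})

    +-congʳ-mod : ∀ a {b c} → b ≡ c mod n → b + a ≡ c + a mod n
    +-congʳ-mod a b≡c = +-cong-mod b≡c (≡-mod-refl {a})

    *-congˡ-mod : ∀ a {b c} → b ≡ c mod n → a * b ≡ a * c mod n
    *-congˡ-mod a = *-cong-mod (≡-mod-refl {a})

    ^-cong-mod : ∀ {a b} m → a ≡ b mod n → a ^ m ≡ b ^ m mod n
    ^-cong-mod zero    _   = ≡-mod-refl
    ^-cong-mod (suc m) a≡b = *-cong-mod a≡b (^-cong-mod m a≡b)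

    ≡-mod-isEquivalence : IsEquivalence (λ a b → a ≡ b mod n)
    ≡-mod-isEquivalence = record { refl = ≡-mod-refl ; sym = ≡-mod-sym ; trans = ≡-mod-trans }

  mod-setoid : ℕ → Setoid _ _
  mod-setoid n = record { isEquivalence = ≡-mod-isEquivalence {n} }

  module ≡-mod-Reasoning (n : ℕ) where
    open import Relation.Binary.Reasoning.Setoid (mod-setoid n) public

  decide-mod : ∀ {n a b} {_ : True (+ n ∣? (a - b))} → a ≡ b mod n
  decide-mod {_} {_} {_} {n∣a-b} = mod-by (toWitness n∣a-b)

  refute-mod : ∀ {n a b} → a ≡ b mod n → {False (+ n ∣? (a - b))} → ⊥
  refute-mod a≡b {n∤a-b} = toWitnessFalse n∤a-b (divides-difference a≡b)

  ≡-mod-weaken : ∀ {m n a b} → m ℕ.∣ n → a ≡ b mod n → a ≡ b mod m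
  ≡-mod-weaken m∣n (mod-by n∣a-b) = mod-by (∣ℤ-trans (∣ᵤ⇒∣ m∣n) n∣a-b)

  ∣⇒≡0-mod : ∀ {n} a → n ℕ.∣ ∣ a ∣ → a ≡ 0ℤ mod n
  ∣⇒≡0-mod a n∣a = mod-by′ (∣ᵤ⇒∣ n∣a) (sym (ℤ.+-identityʳ a))

  ≡0-mod⇒∣ : ∀ {n a} → a ≡ 0ℤ mod n → n ℕ.∣ ∣ a ∣
  ≡0-mod⇒∣ {n} {a} (mod-by n∣a-0) = subst (λ b → n ℕ.∣ ∣ b ∣) (ℤ.+-identityʳ a) (∣⇒∣ᵤ n∣a-0)

  ≢0-mod : ∀ {n} a → 0 < ∣ a ∣ → ∣ a ∣ < n → ¬ (a ≡ 0ℤ mod n)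
  ≢0-mod a 0<∣a∣ ∣a∣<n a≡0 = ℕ.<⇒≱ ∣a∣<n (ℕ.∣⇒≤ {{ℕ.>-nonZero 0<∣a∣}} (≡0-mod⇒∣ a≡0))

  multiple≡0-mod : ∀ {n} a → a * + n ≡ 0ℤ mod n
  multiple≡0-mod {n} a = ∣⇒≡0-mod (a * + n) (subst (n ℕ.∣_) (sym (ℤ.abs-* a (+ n))) (ℕ.n∣m*n ∣ a ∣))

  n≡0-mod : ∀ n → + n ≡ 0ℤ mod n
  n≡0-mod n = subst (_≡ 0ℤ mod n) (ℤ.*-identityˡ (+ n)) (multiple≡0-mod 1ℤ)

  ^-suc≡0-mod : ∀ n a → (+ n) ^ suc a ≡ 0ℤ mod n
  ^-suc≡0-mod n a = subst (_≡ 0ℤ mod n) (ℤ.*-comm ((+ n) ^ a) (+ n)) (multiple≡0-mod ((+ n) ^ a))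

  ≡-mod⇒-≡0 : ∀ {n a b} → a ≡ b mod n → a - b ≡ 0ℤ mod n
  ≡-mod⇒-≡0 {a = a} {b} (mod-by n∣a-b) = mod-by′ n∣a-b (sym (ℤ.+-identityʳ (a - b)))

  -1≢1-mod : ∀ {n} → 2 < n → ¬ (- 1ℤ ≡ 1ℤ mod n)
  -1≢1-mod 2<n = ≢0-mod (- 1ℤ - 1ℤ) (s≤s z≤n) 2<n ∘ ≡-mod⇒-≡0

  +-cancelˡ-mod : ∀ {n} a {b c} → a + b ≡ a + c mod n → b ≡ c mod n
  +-cancelˡ-mod {n} a {b} {c} a+b≡a+c = begin
    b            ≡⟨ lemma a b ⟩
    a + b - a    ≈⟨ +-congʳ-mod (- a) a+b≡a+c ⟩
    a + c - a    ≡⟨ lemma a c ⟨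
    c            ∎
    where
    open ≡-mod-Reasoning n
    lemma : ∀ a b → b ≡ a + b - a
    lemma = solve-∀

  +≡0⇒≡neg-mod : ∀ {n} a b → a + b ≡ 0ℤ mod n → a ≡ - b mod n
  +≡0⇒≡neg-mod {n} a b a+b≡0 = begin
    a            ≡⟨ lemma a b ⟩
    a + b - b    ≈⟨ +-congʳ-mod (- b) a+b≡0 ⟩
    0ℤ - b       ≡⟨ ℤ.+-identityˡ (- b) ⟩
    - b          ∎
    where
    open ≡-mod-Reasoning n
    lemma : ∀ a b → a ≡ a + b - b
    lemma = solve-∀

  prime-split-mod : ∀ {p} → Prime p → ∀ a b → a * b ≡ 0ℤ mod p → a ≡ 0ℤ mod p ⊎ b ≡ 0ℤ mod p
  prime-split-mod {p} pp a b ab≡0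
    with euclidsLemma ∣ a ∣ ∣ b ∣ pp (subst (p ℕ.∣_) (ℤ.abs-* a b) (≡0-mod⇒∣ ab≡0))
  ... | inj₁ p∣a = inj₁ (∣⇒≡0-mod a p∣a)
  ... | inj₂ p∣b = inj₂ (∣⇒≡0-mod b p∣b)

  prime-cancelʳ-mod : ∀ {p} → Prime p → ∀ {a b} c → ¬ (c ≡ 0ℤ mod p) → a * c ≡ b * c mod p → a ≡ b mod p
  prime-cancelʳ-mod {p} pp {a} {b} c c≢0 ac≡bc
    with prime-split-mod pp (a - b) c (subst (_≡ 0ℤ mod p) (lemma a b c) (≡-mod⇒-≡0 ac≡bc))
    where
    lemma : ∀ a b c → a * c - b * c ≡ (a - b) * c
    lemma = solve-∀
  ... | inj₁ (mod-by p∣a-b-0) = mod-by′ p∣a-b-0 (ℤ.+-identityʳ (a - b))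
  ... | inj₂ c≡0              = contradiction c≡0 c≢0

  pos-^ : ∀ m n → + (m ℕ.^ n) ≡ (+ m) ^ n
  pos-^ m zero    = refl
  pos-^ m (suc n) = trans (ℤ.pos-* m (m ℕ.^ n)) (cong (+ m *_) (pos-^ m n))

  pos-^≡^+^ : ∀ c m a i b j → c ℕ.^ m ≡ a ℕ.^ i ℕ.+ b ℕ.^ j → (+ c) ^ m ≡ (+ a) ^ i + (+ b) ^ j
  pos-^≡^+^ c m a i b j eq =
    trans (sym (pos-^ c m)) (trans (cong +_ eq) (trans (ℤ.pos-+ (a ℕ.^ i) _) (cong₂ _+_ (pos-^ a i) (pos-^ b j))))

  two-pow-≡0-mod : ∀ n i → (+ 2) ^ (n ℕ.+ i) ≡ 0ℤ mod (2 ℕ.^ n)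
  two-pow-≡0-mod n i = subst (_≡ 0ℤ mod (2 ℕ.^ n)) eq (multiple≡0-mod ((+ 2) ^ i))
    where
    eq : (+ 2) ^ i * + (2 ℕ.^ n) ≡ (+ 2) ^ (n ℕ.+ i)
    eq = trans (ℤ.*-comm ((+ 2) ^ i) _) (trans (cong (_* (+ 2) ^ i) (pos-^ 2 n)) (sym (ℤ.^-distribˡ-+-* (+ 2) n i)))

  ≡+multiple⇒≡-mod : ∀ {m n r} k → m ≡ r ℕ.+ k ℕ.* n → + m ≡ + r mod n
  ≡+multiple⇒≡-mod {n = n} {r} k refl = mod-by′ (∣n⇒∣m*n (+ k) (∣-refl {+ n})) (begin
    + k * + n                  ≡⟨ lemma (+ r) (+ k) (+ n) ⟩
    + r + + k * + n - + r      ≡⟨ cong (_- + r) (trans (ℤ.pos-+ r (k ℕ.* n)) (cong (_+_ (+ r)) (ℤ.pos-* k n))) ⟨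
    + (r ℕ.+ k ℕ.* n) - + r    ∎)
    where
    open ≡-Reasoning
    lemma : ∀ r k n → k * n ≡ r + k * n - r
    lemma = solve-∀

  %⇒≡-mod : ∀ {m n r} .{{_ : ℕ.NonZero n}} → m ℕ.% n ≡ r → + m ≡ + r mod n
  %⇒≡-mod {m} {n} refl = ≡+multiple⇒≡-mod (m ℕ./ n) (m≡m%n+[m/n]*n m n)

  module _ {n a} (a²≡1 : a * a ≡ 1ℤ mod n) where

    ^-even-mod : ∀ t → a ^ (2 ℕ.* t) ≡ 1ℤ mod n
    ^-even-mod t = begin
      a ^ (2 ℕ.* t)       ≡⟨ ℤ.^-*-assoc a 2 t ⟨
      (a * (a * 1ℤ)) ^ t  ≡⟨ cong (λ b → (a * b) ^ t) (ℤ.*-identityʳ a) ⟩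
      (a * a) ^ t         ≈⟨ ^-cong-mod t a²≡1 ⟩
      1ℤ ^ t              ≡⟨ ℤ.^-zeroˡ t ⟩
      1ℤ                  ∎
      where open ≡-mod-Reasoning n

    ^-odd-mod : ∀ t → a ^ suc (2 ℕ.* t) ≡ a mod n
    ^-odd-mod t = begin
      a * a ^ (2 ℕ.* t)  ≈⟨ *-congˡ-mod a (^-even-mod t) ⟩
      a * 1ℤ             ≡⟨ ℤ.*-identityʳ a ⟩
      a                  ∎
      where open ≡-mod-Reasoning n

module Parity where

  open Congruence
  open import Data.Nat
  open import Data.Nat.Tactic.RingSolver using (solve-∀)
  open import Data.Integer as ℤ using (+_; 1ℤ)
  import Data.Integer.Properties as ℤ
  open import Data.Product using (∃; _,_)
  open import Data.Empty using (⊥-elim)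
  open import Relation.Binary.PropositionalEquality

  data EvenOdd : ℕ → Set where
    even : ∀ t → EvenOdd (2 * t)
    odd  : ∀ t → EvenOdd (suc (2 * t))

  evenOdd : ∀ n → EvenOdd n
  evenOdd zero    = even 0
  evenOdd (suc n) with evenOdd n
  ... | even t = odd t
  ... | odd t  = subst EvenOdd (lemma t) (even (suc t))
    where
    lemma : ∀ t → 2 * suc t ≡ suc (suc (2 * t))
    lemma = solve-∀

  odd-^ : ∀ t n → ∃ λ b → suc (2 * t) ^ n ≡ suc (2 * b)
  odd-^ t zero    = 0 , refl
  odd-^ t (suc n) with odd-^ t n
  ... | b , eq = t + b + 2 * t * b , trans (cong (suc (2 * t) *_) eq) (lemma t b)
    where
    lemma : ∀ t b → suc (2 * t) * suc (2 * b) ≡ suc (2 * (t + b + 2 * t * b))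
    lemma = solve-∀

  odd-square-mod : ∀ t → + suc (2 * t) ℤ.* + suc (2 * t) ≡ 1ℤ mod 8
  odd-square-mod t = subst (_≡ 1ℤ mod 8) (ℤ.pos-* (suc (2 * t)) (suc (2 * t))) (square (evenOdd t))
    where
    square : ∀ {t} → EvenOdd t → + (suc (2 * t) * suc (2 * t)) ≡ 1ℤ mod 8
    square (even s) = ≡+multiple⇒≡-mod (2 * s * s + s) (lemma s)
      where
      lemma : ∀ s → suc (2 * (2 * s)) * suc (2 * (2 * s)) ≡ 1 + (2 * s * s + s) * 8
      lemma = solve-∀
    square (odd s)  = ≡+multiple⇒≡-mod (2 * s * s + 3 * s + 1) (lemma s)
      where
      lemma : ∀ s → suc (2 * suc (2 * s)) * suc (2 * suc (2 * s)) ≡ 1 + (2 * s * s + 3 * s + 1) * 8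
      lemma = solve-∀

  ^≡^-mod-4⇒mod-3 : ∀ {a b} m n → a ≡ + 3 mod 4 → b ≡ + 3 mod 4 → a ≡ + 2 mod 3 → b ≡ + 2 mod 3 →
                    a ℤ.^ m ≡ b ℤ.^ n mod 4 → a ℤ.^ m ≡ b ℤ.^ n mod 3
  ^≡^-mod-4⇒mod-3 {a} {b} m n a≡3 b≡3 a≡2 b≡2 aᵐ≡bⁿ = cases (evenOdd m) (evenOdd n)
    where
    square≡1 : ∀ {c k r} → c ≡ + r mod k → + r ℤ.* + r ≡ 1ℤ mod k → c ℤ.* c ≡ 1ℤ mod k
    square≡1 c≡r r²≡1 = ≡-mod-trans (*-cong-mod c≡r c≡r) r²≡1
    cases : EvenOdd m → EvenOdd n → a ℤ.^ m ≡ b ℤ.^ n mod 3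
    cases (even s) (even t) = ≡-mod-trans (^-even-mod (square≡1 a≡2 decide-mod) s)
                                          (≡-mod-sym (^-even-mod (square≡1 b≡2 decide-mod) t))
    cases (odd s)  (odd t)  = ≡-mod-trans (^-odd-mod (square≡1 a≡2 decide-mod) s)
                                (≡-mod-trans (≡-mod-trans a≡2 (≡-mod-sym b≡2))
                                             (≡-mod-sym (^-odd-mod (square≡1 b≡2 decide-mod) t)))
    cases (even s) (odd t)  = ⊥-elim (refute-mod (begin
      1ℤ                 ≈⟨ ^-even-mod (square≡1 a≡3 decide-mod) s ⟨
      a ℤ.^ (2 * s)      ≈⟨ aᵐ≡bⁿ ⟩
      b ℤ.^ suc (2 * t)  ≈⟨ ^-odd-mod (square≡1 b≡3 decide-mod) t ⟩
      b                  ≈⟨ b≡3 ⟩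
      + 3                ∎))
      where open ≡-mod-Reasoning 4
    cases (odd s)  (even t) = ⊥-elim (refute-mod (begin
      + 3                ≈⟨ a≡3 ⟨
      a                  ≈⟨ ^-odd-mod (square≡1 a≡3 decide-mod) s ⟨
      a ℤ.^ suc (2 * s)  ≈⟨ aᵐ≡bⁿ ⟩
      b ℤ.^ (2 * t)      ≈⟨ ^-even-mod (square≡1 b≡3 decide-mod) t ⟩
      1ℤ                 ∎))
      where open ≡-mod-Reasoning 4

module Arithmetic where

  open import Data.Nat
  open import Data.Nat.Properties
  open import Data.Nat.Divisibility
  open import Data.Nat.DivMod using (m≡m%n+[m/n]*n)
  open import Data.Nat.Coprimality using (Coprime; coprime-divisor)
  open import Data.Nat.Primality using (Prime; euclidsLemma; prime⇒irreducible; prime⇒nonTrivial; prime?; prime[2])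
  open import Data.Nat.Tactic.RingSolver using (solve-∀)
  open import Data.Product using (_×_; _,_)
  open import Data.Sum using (inj₁; inj₂; [_,_]′)
  open import Function using (id; _$_)
  open import Relation.Binary.Definitions using (tri<; tri≈; tri>)
  open import Relation.Nullary using (¬_; contradiction)
  open import Relation.Nullary.Decidable using (toWitness)
  open import Relation.Binary.PropositionalEquality

  m%n≡r⇒m≡r+[m/n]*n : ∀ {m n r} .{{_ : NonZero n}} → m % n ≡ r → m ≡ r + (m / n) * n
  m%n≡r⇒m≡r+[m/n]*n {m} {n} refl = m≡m%n+[m/n]*n m n

  ^-distribʳ-* : ∀ m n y → (m * n) ^ y ≡ m ^ y * n ^ y
  ^-distribʳ-* m n zero    = refl
  ^-distribʳ-* m n (suc y) = trans (cong (m * n *_) (^-distribʳ-* m n y)) (lemma m n (m ^ y) (n ^ y))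
    where
    lemma : ∀ m n a b → m * n * (a * b) ≡ m * a * (n * b)
    lemma = solve-∀

  square-injective : ∀ {m n} → m * m ≡ n * n → m ≡ n
  square-injective {m} {n} m²≡n² with <-cmp m n
  ... | tri< m<n _ _ = contradiction m²≡n² (<⇒≢ (*-mono-< m<n m<n))
  ... | tri≈ _ m≡n _ = m≡n
  ... | tri> _ _ n<m = contradiction (sym m²≡n²) (<⇒≢ (*-mono-< n<m n<m))

  1≡m²+nʸ⇒y≡0×m≡0 : ∀ {m n} y → 1 < n → 1 ≡ m * m + n ^ y → y ≡ 0 × m ≡ 0
  1≡m²+nʸ⇒y≡0×m≡0 {m} zero    _   eq =
    refl , [ id , id ]′ (m*n≡0⇒m≡0∨n≡0 m (+-cancelʳ-≡ 1 (m * m) 0 (sym eq)))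
  1≡m²+nʸ⇒y≡0×m≡0 {m} {n} (suc y) 1<n eq =
    contradiction eq $ <⇒≢ (≤-trans 1<n (≤-trans (m≤m*n n (n ^ y)) (m≤n+m _ (m * m))))
    where instance _ = m^n≢0 n y {{>-nonZero (<-trans (s≤s z≤n) 1<n)}}

  prime>1 : ∀ {p} → Prime p → 1 < p
  prime>1 {p} pp = nonTrivial⇒n>1 p {{prime⇒nonTrivial pp}}

  prime-∣-prime : ∀ {p q} → Prime p → Prime q → p ∣ q → p ≡ q
  prime-∣-prime pp pq p∣q with prime⇒irreducible pq p∣q
  ... | inj₁ refl = contradiction (prime>1 pp) (<-irrefl refl)
  ... | inj₂ p≡q  = p≡q

  prime-∣-^ : ∀ {q m} n → Prime q → q ∣ m ^ n → q ∣ m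
  prime-∣-^ zero    pq q∣1 = contradiction (∣1⇒≡1 q∣1) (>⇒≢ (prime>1 pq))
  prime-∣-^ {m = m} (suc n) pq q∣mⁿ⁺¹ with euclidsLemma m (m ^ n) pq q∣mⁿ⁺¹
  ... | inj₁ q∣m  = q∣m
  ... | inj₂ q∣mⁿ = prime-∣-^ n pq q∣mⁿ

  coprime-^-cancel : ∀ {r m} j X → Coprime r m → r ∣ m ^ j * X → r ∣ X
  coprime-^-cancel {r} zero    X _   r∣X     = subst (r ∣_) (+-identityʳ X) r∣X
  coprime-^-cancel {r} {m} (suc j) X cop r∣mʲ⁺¹X =
    coprime-^-cancel j X cop (coprime-divisor cop (subst (r ∣_) (*-assoc m (m ^ j) X) r∣mʲ⁺¹X))

  odd-coprime-2 : ∀ t → Coprime (suc (2 * t)) 2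
  odd-coprime-2 t {d} (d∣r , d∣2) with prime⇒irreducible prime[2] d∣2
  ... | inj₁ d≡1 = d≡1
  ... | inj₂ d≡2 = contradiction (subst (_∣ suc (2 * t)) d≡2 d∣r) 2∤odd
    where
    2∤odd : ¬ 2 ∣ suc (2 * t)
    2∤odd (divides c eq) = even≢odd c t (trans (*-comm 2 c) (sym eq))

  prime[3] : Prime 3
  prime[3] = toWitness {a? = prime? 3} _

  prime[13] : Prime 13
  prime[13] = toWitness {a? = prime? 13} _

module OddSquareDifference where

  open import Data.Nat
  open import Data.Nat.Properties
  open import Data.Nat.Divisibility
  open import Data.Nat.Primality using (Prime; euclidsLemma; prime⇒nonZero; prime[2])
  open import Data.Nat.Tactic.RingSolver using (solve-∀)
  open import Data.Product using (∃; ∃₂; _×_; _,_)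
  open import Data.Sum using (_⊎_; inj₁; inj₂)
  open import Relation.Nullary using (¬_; Dec; contradiction; yes; no)
  open import Relation.Binary.PropositionalEquality

  prime-power-∣-cancel : ∀ {q u v} y → Prime q → ¬ q ∣ u → q ^ y ∣ u * v → q ^ y ∣ v
  prime-power-∣-cancel zero _ _ _ = 1∣ _
  prime-power-∣-cancel {q} {u} (suc y) pq q∤u qʸ⁺¹∣uv
    with euclidsLemma u _ pq (∣-trans (m∣m*n (q ^ y)) qʸ⁺¹∣uv)
  ... | inj₁ q∣u = contradiction q∣u q∤u
  ... | inj₂ (divides w refl) =
    subst (q ^ suc y ∣_) (*-comm q w) (*-monoʳ-∣ q (prime-power-∣-cancel y pq q∤u (*-cancelˡ-∣ q q*qʸ∣q*uw)))
    where
    instance _ = prime⇒nonZero pq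
    lemma : ∀ u w q → u * (w * q) ≡ q * (u * w)
    lemma = solve-∀
    q*qʸ∣q*uw : q * q ^ y ∣ q * (u * w)
    q*qʸ∣q*uw = subst (q * q ^ y ∣_) (lemma u w q) qʸ⁺¹∣uv

  prime-power-factors : ∀ {r} n a b → Prime r → a * b ≡ r ^ n →
                        ∃₂ λ α β → a ≡ r ^ α × b ≡ r ^ β × α + β ≡ n
  prime-power-factors zero a b _ ab≡1 = 0 , 0 , m*n≡1⇒m≡1 a b ab≡1 , m*n≡1⇒n≡1 a b ab≡1 , refl
  prime-power-factors {r} (suc n) a b pr ab≡rⁿ⁺¹
    with euclidsLemma a b pr (subst (r ∣_) (sym ab≡rⁿ⁺¹) (m∣m*n (r ^ n)))
  ... | inj₁ (divides a′ refl)
    with prime-power-factors n a′ b pr (*-cancelˡ-≡ _ _ r (trans (lemma a′ r b) ab≡rⁿ⁺¹))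
    where
    instance _ = prime⇒nonZero pr
    lemma : ∀ a r b → r * (a * b) ≡ a * r * b
    lemma = solve-∀
  ...   | α , β , refl , refl , refl = suc α , β , *-comm (r ^ α) r , refl , refl
  prime-power-factors {r} (suc n) a b pr ab≡rⁿ⁺¹ | inj₂ (divides b′ refl)
    with prime-power-factors n a b′ pr (*-cancelˡ-≡ _ _ r (trans (lemma a b′ r) ab≡rⁿ⁺¹))
    where
    instance _ = prime⇒nonZero pr
    lemma : ∀ a b r → r * (a * b) ≡ a * (b * r)
    lemma = solve-∀
  ...   | α , β , refl , refl , refl = α , suc β , refl , *-comm (r ^ β) r , +-suc α β

  factors-of-2ʲqʸ : ∀ {q j y u v} → Prime q → ¬ q ∣ u → u * v ≡ 2 ^ j * q ^ y →
                    ∃₂ λ α β → u ≡ 2 ^ α × v ≡ 2 ^ β * q ^ y × α + β ≡ j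
  factors-of-2ʲqʸ {q} {j} {y} {u} {v} pq q∤u uv≡2ʲqʸ
    with prime-power-∣-cancel y pq q∤u (subst (q ^ y ∣_) (sym uv≡2ʲqʸ) (n∣m*n (2 ^ j)))
  ... | divides c refl
    with prime-power-factors j u c prime[2] (*-cancelʳ-≡ _ _ (q ^ y) uc·qʸ≡2ʲ·qʸ)
    where
    instance _ = m^n≢0 q y {{prime⇒nonZero pq}}
    uc·qʸ≡2ʲ·qʸ : u * c * q ^ y ≡ 2 ^ j * q ^ y
    uc·qʸ≡2ʲ·qʸ = trans (*-assoc u c (q ^ y)) uv≡2ʲqʸ
  ...   | α , β , u≡2ᵅ , refl , α+β≡j = α , β , u≡2ᵅ , refl , α+β≡j

  2ᵅ+2ᵝQ≡odd⇒α≡0⊎β≡0 : ∀ α β Q b → 2 ^ α + 2 ^ β * Q ≡ suc (2 * b) → α ≡ 0 ⊎ β ≡ 0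
  2ᵅ+2ᵝQ≡odd⇒α≡0⊎β≡0 zero    _       _ _ _ = inj₁ refl
  2ᵅ+2ᵝQ≡odd⇒α≡0⊎β≡0 (suc α) zero    _ _ _ = inj₂ refl
  2ᵅ+2ᵝQ≡odd⇒α≡0⊎β≡0 (suc α) (suc β) Q b e =
    contradiction (trans (lemma (2 ^ α) (2 ^ β) Q) e) (even≢odd (2 ^ α + 2 ^ β * Q) b)
    where
    lemma : ∀ x y Q → 2 * (x + y * Q) ≡ 2 * x + 2 * y * Q
    lemma = solve-∀

  factor-sum-of-2ʲqʸ : ∀ {q j y u v b} → Prime q → ¬ q ∣ u → u * v ≡ 2 ^ j * q ^ y → u + v ≡ suc (2 * b) →
                       u + v ≡ 1 + 2 ^ j * q ^ y ⊎ u + v ≡ 2 ^ j + q ^ y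
  factor-sum-of-2ʲqʸ {q} {j} {y} {b = b} pq q∤u uv≡2ʲqʸ u+v≡odd
    with factors-of-2ʲqʸ {j = j} {y} pq q∤u uv≡2ʲqʸ
  ... | α , β , refl , refl , refl with 2ᵅ+2ᵝQ≡odd⇒α≡0⊎β≡0 α β (q ^ y) b u+v≡odd
  ...   | inj₁ refl = inj₁ refl
  ...   | inj₂ refl = inj₂ (cong₂ _+_ (cong (2 ^_) (sym (+-identityʳ α))) (*-identityˡ (q ^ y)))

  odd-square-difference : ∀ b t N → suc (2 * b) * suc (2 * b) ≡ suc (2 * t) * suc (2 * t) + 4 * N →
                          ∃ λ e → b ≡ t + e × e * (e + suc (2 * t)) ≡ N
  odd-square-difference b t N eq with m≤n⇒∃[o]m+o≡n (≮⇒≥ b≮t)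
    where
    b≮t : ¬ b < t
    b≮t b<t = <⇒≢ (<-≤-trans (*-mono-< P<z P<z) (m≤m+n _ _)) eq
      where
      P<z : suc (2 * b) < suc (2 * t)
      P<z = s≤s (*-monoʳ-< 2 b<t)
  ... | e , refl = e , refl , *-cancelˡ-≡ _ N 4 (+-cancelˡ-≡ (suc (2 * t) * suc (2 * t)) _ _ (trans (lemma t e) eq))
    where
    lemma : ∀ t e → suc (2 * t) * suc (2 * t) + 4 * (e * (e + suc (2 * t))) ≡ suc (2 * (t + e)) * suc (2 * (t + e))
    lemma = solve-∀

  odd-square-difference-split : ∀ {q j y} b t → Prime q → ¬ q ∣ suc (2 * b) →
    suc (2 * b) * suc (2 * b) ≡ suc (2 * t) * suc (2 * t) + 4 * (2 ^ j * q ^ y) →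
    suc (2 * b) ≡ 1 + 2 ^ j * q ^ y ⊎ suc (2 * b) ≡ 2 ^ j + q ^ y
  odd-square-difference-split {q} {j} {y} b t pq q∤P eq with odd-square-difference b t (2 ^ j * q ^ y) eq
  ... | e , refl , e[e+z]≡N = subst Cases (sum≡P t e) (split (q ∣? e))
    where
    z = suc (2 * t)
    Cases : ℕ → Set
    Cases P = P ≡ 1 + 2 ^ j * q ^ y ⊎ P ≡ 2 ^ j + q ^ y
    sum≡P : ∀ t e → e + (e + suc (2 * t)) ≡ suc (2 * (t + e))
    sum≡P = solve-∀
    split : Dec (q ∣ e) → Cases (e + (e + z))
    split (no q∤e)  = factor-sum-of-2ʲqʸ {j = j} {y} {b = t + e} pq q∤e e[e+z]≡N (sum≡P t e)
    split (yes q∣e) = subst Cases (+-comm (e + z) e)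
      (factor-sum-of-2ʲqʸ {j = j} {y} {b = t + e} pq q∤e+z
        (trans (*-comm (e + z) e) e[e+z]≡N) (trans (+-comm (e + z) e) (sum≡P t e)))
      where
      q∤e+z : ¬ q ∣ e + z
      q∤e+z q∣e+z = q∤P (subst (q ∣_) (sum≡P t e) (∣m∣n⇒∣m+n q∣e q∣e+z))

module FermatLittle where

  open Congruence
  open Arithmetic using (prime>1)
  open import Data.Nat as ℕ using (ℕ; zero; suc; _<_; _!; z≤n; s≤s)
  import Data.Nat.Properties as ℕ
  import Data.Nat.Divisibility as ℕ
  open import Data.Nat.DivMod using (m/n*n≡m)
  open import Data.Nat.Primality using (Prime; euclidsLemma; prime⇒nonZero)
  open import Data.Nat.Combinatorics using (_C_; nCn≡1; nCk≡n!/k![n-k]!; k![n∸k]!∣n!)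
  open import Data.Fin using (Fin; zero; suc; toℕ; fromℕ)
  open import Data.Fin.Properties using (toℕ-fromℕ)
  open import Data.Integer using (+_; _+_; _*_; _^_; 0ℤ; 1ℤ)
  import Data.Integer.Properties as ℤ
  open import Data.Sum using (inj₁; inj₂)
  open import Function using (_∘_)
  open import Relation.Nullary using (¬_; contradiction)
  open import Relation.Binary.PropositionalEquality
  open import Algebra.Bundles using (CommutativeSemiring)
  import Algebra.Properties.CommutativeSemiring.Binomial as Binomial
  import Algebra.Properties.Monoid.Sum as MonoidSum
  import Algebra.Definitions.RawSemiring as RawSemiring

  prime∤! : ∀ {p m} → Prime p → m < p → ¬ p ℕ.∣ m !
  prime∤! {p} {zero}  pp _   p∣1 = ℕ.<⇒≢ (prime>1 pp) (sym (ℕ.∣1⇒≡1 p∣1))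
  prime∤! {p} {suc m} pp m<p p∣m! with euclidsLemma (suc m) (m !) pp p∣m!
  ... | inj₁ p∣1+m = ℕ.<⇒≱ m<p (ℕ.∣⇒≤ p∣1+m)
  ... | inj₂ p∣m!  = prime∤! pp (ℕ.<-trans (ℕ.n<1+n m) m<p) p∣m!

  nCk*k!*[n∸k]!≡n! : ∀ {n k} → k ℕ.≤ n → (n C k) ℕ.* (k ! ℕ.* (n ℕ.∸ k) !) ≡ n !
  nCk*k!*[n∸k]!≡n! {n} {k} k≤n =
    trans (cong (ℕ._* (k ! ℕ.* (n ℕ.∸ k) !)) (nCk≡n!/k![n-k]! k≤n)) (m/n*n≡m (k![n∸k]!∣n! k≤n))
    where instance _ = k ℕ.!* (n ℕ.∸ k) !≢0

  n∣n! : ∀ {n} → .{{ℕ.NonZero n}} → n ℕ.∣ n !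
  n∣n! {suc n} = ℕ.m∣m*n (n !)

  prime∣pCk : ∀ {p k} → Prime p → 0 < k → k < p → p ℕ.∣ p C k
  prime∣pCk {p} {k} pp 0<k k<p
    with euclidsLemma (p C k) _ pp
           (subst (p ℕ.∣_) (sym (nCk*k!*[n∸k]!≡n! (ℕ.<⇒≤ k<p))) (n∣n! {{prime⇒nonZero pp}}))
  ... | inj₁ p∣pCk = p∣pCk
  ... | inj₂ p∣k!*[p∸k]! with euclidsLemma (k !) ((p ℕ.∸ k) !) pp p∣k!*[p∸k]!
  ...   | inj₁ p∣k!      = contradiction p∣k! (prime∤! pp k<p)
  ...   | inj₂ p∣[p∸k]! = contradiction p∣[p∸k]! (prime∤! pp (ℕ.∸-monoʳ-< 0<k (ℕ.<⇒≤ k<p)))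

  -- The library's binomial theorem is phrased with the generic semiring multiple _×_ and power _^_.
  private
    module ℕ-Binomial = Binomial ℕ.+-*-commutativeSemiring
    module ℕ-Sum      = MonoidSum (CommutativeSemiring.+-monoid ℕ.+-*-commutativeSemiring)
    module ℕ-Raw      = RawSemiring (CommutativeSemiring.rawSemiring ℕ.+-*-commutativeSemiring)

    ×≡* : ∀ n x → n ℕ-Raw.× x ≡ n ℕ.* x
    ×≡* zero    x = refl
    ×≡* (suc n) x = cong (x ℕ.+_) (×≡* n x)

    ^≡^ : ∀ x n → x ℕ-Raw.^ n ≡ x ℕ.^ n
    ^≡^ x zero    = refl
    ^≡^ x (suc n) = cong (x ℕ.*_) (^≡^ x n)

  sum≡last-mod : ∀ {d} m (s : Fin (suc m) → ℕ) → (∀ i → toℕ i < m → d ℕ.∣ s i) →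
                 + ℕ-Sum.sum s ≡ + s (fromℕ m) mod d
  sum≡last-mod zero    s _ = ≡-mod-reflexive (cong +_ (ℕ.+-identityʳ (s zero)))
  sum≡last-mod {d} (suc m) s d∣s = begin
    + (s zero ℕ.+ ℕ-Sum.sum (s ∘ suc))  ≡⟨ ℤ.pos-+ (s zero) _ ⟩
    + s zero + + ℕ-Sum.sum (s ∘ suc)    ≈⟨ +-cong-mod (∣⇒≡0-mod (+ s zero) (d∣s zero (s≤s z≤n)))
                                                     (sum≡last-mod m (s ∘ suc) (λ i i<m → d∣s (suc i) (s≤s i<m))) ⟩
    0ℤ + + s (fromℕ (suc m))             ≡⟨ ℤ.+-identityˡ _ ⟩
    + s (fromℕ (suc m))                  ∎
    where open ≡-mod-Reasoning d

  private
    binomialTerm-last : ∀ x n → ℕ-Binomial.binomialTerm x 1 n (fromℕ n) ≡ x ℕ.^ n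
    binomialTerm-last x n = begin
      (n C toℕ (fromℕ n)) ℕ-Raw.× (x ℕ-Raw.^ toℕ (fromℕ n) ℕ.* 1 ℕ-Raw.^ (n ℕ.∸ toℕ (fromℕ n)))
        ≡⟨ ×≡* (n C toℕ (fromℕ n)) (x ℕ-Raw.^ toℕ (fromℕ n) ℕ.* 1 ℕ-Raw.^ (n ℕ.∸ toℕ (fromℕ n))) ⟩
      (n C toℕ (fromℕ n)) ℕ.* (x ℕ-Raw.^ toℕ (fromℕ n) ℕ.* 1 ℕ-Raw.^ (n ℕ.∸ toℕ (fromℕ n)))
        ≡⟨ cong (λ k → (n C k) ℕ.* (x ℕ-Raw.^ k ℕ.* 1 ℕ-Raw.^ (n ℕ.∸ k))) (toℕ-fromℕ n) ⟩
      (n C n) ℕ.* (x ℕ-Raw.^ n ℕ.* 1 ℕ-Raw.^ (n ℕ.∸ n))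
        ≡⟨ cong₂ (λ c e → c ℕ.* (x ℕ-Raw.^ n ℕ.* 1 ℕ-Raw.^ e)) (nCn≡1 n) (ℕ.n∸n≡0 n) ⟩
      1 ℕ.* (x ℕ-Raw.^ n ℕ.* 1)
        ≡⟨ trans (ℕ.*-identityˡ _) (ℕ.*-identityʳ _) ⟩
      x ℕ-Raw.^ n
        ≡⟨ ^≡^ x n ⟩
      x ℕ.^ n ∎
      where open ≡-Reasoning

    binomialTerm-first : ∀ x n → ℕ-Binomial.binomialTerm x 1 n zero ≡ 1
    binomialTerm-first x n = trans (ℕ.+-identityʳ _) (trans (ℕ.*-identityˡ _) (trans (^≡^ 1 n) (ℕ.^-zeroˡ n)))

  freshman-mod : ∀ {p} → Prime p → ∀ a → (+ a + 1ℤ) ^ p ≡ (+ a) ^ p + 1ℤ mod p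
  freshman-mod {suc m} pp a = begin
    (+ a + 1ℤ) ^ suc m                        ≡⟨ pos-^ (a ℕ.+ 1) (suc m) ⟨
    + ((a ℕ.+ 1) ℕ.^ suc m)                   ≡⟨ cong +_ expansion ⟩
    + (t zero ℕ.+ ℕ-Sum.sum (t ∘ suc))        ≡⟨ ℤ.pos-+ (t zero) _ ⟩
    + t zero + + ℕ-Sum.sum (t ∘ suc)          ≈⟨ +-congˡ-mod (+ t zero) (sum≡last-mod m (t ∘ suc) middle) ⟩
    + t zero + + t (fromℕ (suc m))            ≡⟨ cong₂ (λ u v → + u + + v) (binomialTerm-first a (suc m))
                                                                            (binomialTerm-last a (suc m)) ⟩
    1ℤ + + (a ℕ.^ suc m)                      ≡⟨ ℤ.+-comm 1ℤ (+ (a ℕ.^ suc m)) ⟩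
    + (a ℕ.^ suc m) + 1ℤ                      ≡⟨ cong (_+ 1ℤ) (pos-^ a (suc m)) ⟩
    (+ a) ^ suc m + 1ℤ                        ∎
    where
    open ≡-mod-Reasoning (suc m)
    t = ℕ-Binomial.binomialTerm a 1 (suc m)
    expansion : (a ℕ.+ 1) ℕ.^ suc m ≡ t zero ℕ.+ ℕ-Sum.sum (t ∘ suc)
    expansion = trans (sym (^≡^ (a ℕ.+ 1) (suc m))) (ℕ-Binomial.theorem (suc m) a 1)
    middle : ∀ i → toℕ i < m → suc m ℕ.∣ t (suc i)
    middle i i<m = subst (suc m ℕ.∣_) (sym (×≡* (suc m C suc (toℕ i)) (ℕ-Binomial.binomial a 1 (suc m) (suc i))))
      (ℕ.∣m⇒∣m*n _ (prime∣pCk pp (s≤s z≤n) (s≤s i<m)))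

  fermat-mod : ∀ {p} → Prime p → ∀ a → (+ a) ^ p ≡ + a mod p
  fermat-mod {suc m} pp zero    = ≡-mod-reflexive (ℤ.*-zeroˡ ((+ 0) ^ m))
  fermat-mod {p}     pp (suc a) = begin
    (+ suc a) ^ p    ≡⟨ cong (λ b → (+ b) ^ p) (ℕ.+-comm 1 a) ⟩
    (+ a + 1ℤ) ^ p   ≈⟨ freshman-mod pp a ⟩
    (+ a) ^ p + 1ℤ   ≈⟨ +-congʳ-mod 1ℤ (fermat-mod pp a) ⟩
    + a + 1ℤ         ≡⟨ cong +_ (ℕ.+-comm a 1) ⟩
    + suc a          ∎
    where open ≡-mod-Reasoning p

  fermat-unit-mod : ∀ {p} → Prime p → ∀ a → ¬ (+ a ≡ 0ℤ mod p) → (+ a) ^ (p ℕ.∸ 1) ≡ 1ℤ mod p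
  fermat-unit-mod {suc m} pp a a≢0 = prime-cancelʳ-mod pp (+ a) a≢0 (begin
    (+ a) ^ m * + a  ≡⟨ ℤ.*-comm ((+ a) ^ m) (+ a) ⟩
    (+ a) ^ suc m    ≈⟨ fermat-mod pp a ⟩
    + a              ≡⟨ ℤ.*-identityˡ (+ a) ⟨
    1ℤ * + a         ∎)
    where open ≡-mod-Reasoning (suc m)

  euler-criterion-mod : ∀ {p n} → Prime p → p ≡ suc (2 ℕ.* n) → ∀ z {c} →
                        + z * + z ≡ c mod p → ¬ (c ≡ 0ℤ mod p) → c ^ n ≡ 1ℤ mod p
  euler-criterion-mod {p} {n} pp refl z {c} z²≡c c≢0 = begin
    c ^ n                      ≈⟨ ^-cong-mod n z²≡c ⟨
    (+ z * + z) ^ n            ≡⟨ cong (λ b → (+ z * b) ^ n) (ℤ.*-identityʳ (+ z)) ⟨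
    ((+ z) ^ 2) ^ n            ≡⟨ ℤ.^-*-assoc (+ z) 2 n ⟩
    (+ z) ^ (2 ℕ.* n)          ≈⟨ fermat-unit-mod pp z z≢0 ⟩
    1ℤ                         ∎
    where
    open ≡-mod-Reasoning p
    z≢0 : ¬ (+ z ≡ 0ℤ mod p)
    z≢0 z≡0 = c≢0 (≡-mod-trans (≡-mod-sym z²≡c) (*-cong-mod z≡0 z≡0))

module QuadraticCharacterOfTwo where

  open Congruence
  open FermatLittle using (prime∤!)
  open import Data.Nat as ℕ using (ℕ; zero; suc; _<_; _!)
  import Data.Nat.Properties as ℕ
  open import Data.Nat.Primality using (Prime)
  open import Data.Integer using (ℤ; +_; -_; _+_; _-_; _*_; _^_; 0ℤ; 1ℤ)
  import Data.Integer.Properties as ℤ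
  open import Data.Integer.Divisibility.Signed using (divides)
  open import Data.Integer.Tactic.RingSolver using (solve-∀)
  open import Data.Nat.Tactic.RingSolver using () renaming (solve-∀ to ℕ-solve-∀)
  open import Function using (_∘_)
  open import Relation.Binary.PropositionalEquality

  stepProduct : ℤ → ℕ → ℤ
  stepProduct a zero    = 1ℤ
  stepProduct a (suc L) = stepProduct a L * (a + + 2 * + L)

  stepProduct-split : ∀ a L M → stepProduct a (L ℕ.+ M) ≡ stepProduct a L * stepProduct (a + + 2 * + L) M
  stepProduct-split a L zero    = trans (cong (stepProduct a) (ℕ.+-identityʳ L)) (sym (ℤ.*-identityʳ _))
  stepProduct-split a L (suc M) = begin
    stepProduct a (L ℕ.+ suc M)                                ≡⟨ cong (stepProduct a) (ℕ.+-suc L M) ⟩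
    stepProduct a (L ℕ.+ M) * (a + + 2 * + (L ℕ.+ M))          ≡⟨ cong₂ _*_ (stepProduct-split a L M)
                                                                         (cong (λ k → a + + 2 * k) (ℤ.pos-+ L M)) ⟩
    stepProduct a L * stepProduct b M * (a + + 2 * (+ L + + M)) ≡⟨ lemma (stepProduct a L) (stepProduct b M) a (+ L) (+ M) ⟩
    stepProduct a L * (stepProduct b M * (b + + 2 * + M))      ∎
    where
    open ≡-Reasoning
    b = a + + 2 * + L
    lemma : ∀ x y a l m → x * y * (a + + 2 * (l + m)) ≡ x * (y * ((a + + 2 * l) + + 2 * m))
    lemma = solve-∀

  stepProduct-head : ∀ a L → stepProduct a (suc L) ≡ a * stepProduct (a + + 2) L
  stepProduct-head a L = trans (stepProduct-split a 1 L) (cong₂ _*_ (lemma a) (cong (λ b → stepProduct b L) (lemma′ a)))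
    where
    lemma : ∀ a → 1ℤ * (a + + 2 * 0ℤ) ≡ a
    lemma = solve-∀
    lemma′ : ∀ a → a + + 2 * 1ℤ ≡ a + + 2
    lemma′ = solve-∀

  stepProduct-cong-mod : ∀ {n a b} L → a ≡ b mod n → stepProduct a L ≡ stepProduct b L mod n
  stepProduct-cong-mod zero    _   = ≡-mod-refl
  stepProduct-cong-mod (suc L) a≡b = *-cong-mod (stepProduct-cong-mod L a≡b) (+-congʳ-mod _ a≡b)

  stepProduct-reflect : ∀ a L → stepProduct (+ 2 - (a + + 2 * + L)) L ≡ (- 1ℤ) ^ L * stepProduct a L
  stepProduct-reflect a zero    = refl
  stepProduct-reflect a (suc L) = begin
    stepProduct (+ 2 - (a + + 2 * + suc L)) (suc L)                ≡⟨ stepProduct-head _ L ⟩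
    (+ 2 - (a + + 2 * + suc L)) * stepProduct (+ 2 - (a + + 2 * + suc L) + + 2) L
      ≡⟨ cong (λ b → (+ 2 - (a + + 2 * + suc L)) * stepProduct b L) (lemma a (+ L)) ⟩
    (+ 2 - (a + + 2 * + suc L)) * stepProduct (+ 2 - (a + + 2 * + L)) L
      ≡⟨ cong ((+ 2 - (a + + 2 * + suc L)) *_) (stepProduct-reflect a L) ⟩
    (+ 2 - (a + + 2 * + suc L)) * ((- 1ℤ) ^ L * stepProduct a L)   ≡⟨ lemma′ a (+ L) ((- 1ℤ) ^ L) (stepProduct a L) ⟩
    (- 1ℤ) * (- 1ℤ) ^ L * (stepProduct a L * (a + + 2 * + L))      ∎
    where
    open ≡-Reasoning
    lemma : ∀ a l → + 2 - (a + + 2 * (1ℤ + l)) + + 2 ≡ + 2 - (a + + 2 * l)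
    lemma = solve-∀
    lemma′ : ∀ a l s x → (+ 2 - (a + + 2 * (1ℤ + l))) * (s * x) ≡ (- 1ℤ) * s * (x * (a + + 2 * l))
    lemma′ = solve-∀

  stepProduct-evens : ∀ n → stepProduct (+ 2) n ≡ (+ 2) ^ n * + (n !)
  stepProduct-evens zero    = refl
  stepProduct-evens (suc n) = begin
    stepProduct (+ 2) n * (+ 2 + + 2 * + n)         ≡⟨ cong (_* (+ 2 + + 2 * + n)) (stepProduct-evens n) ⟩
    (+ 2) ^ n * + (n !) * (+ 2 + + 2 * + n)         ≡⟨ lemma ((+ 2) ^ n) (+ (n !)) (+ n) ⟩
    + 2 * (+ 2) ^ n * ((1ℤ + + n) * + (n !))        ≡⟨ cong (+ 2 * (+ 2) ^ n *_) (ℤ.pos-* (suc n) (n !)) ⟨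
    (+ 2) ^ suc n * + (suc n !)                     ∎
    where
    open ≡-Reasoning
    lemma : ∀ x f n → x * f * (+ 2 + + 2 * n) ≡ + 2 * x * ((1ℤ + n) * f)
    lemma = solve-∀

  private
    pos-suc-2* : ∀ h → + suc (2 ℕ.* h) ≡ 1ℤ + + 2 * + h
    pos-suc-2* h = cong (_+_ 1ℤ) (ℤ.pos-* 2 h)

    [2h+3]! : ∀ h → suc (2 ℕ.* suc h) ! ≡ suc (2 ℕ.* suc h) ℕ.* (suc (suc (2 ℕ.* h)) ℕ.* suc (2 ℕ.* h) !)
    [2h+3]! h = cong (suc (2 ℕ.* suc h) ℕ.*_) (cong _! (lemma h))
      where
      lemma : ∀ h → 2 ℕ.* suc h ≡ suc (suc (2 ℕ.* h))
      lemma = ℕ-solve-∀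

  stepProduct-odds*evens : ∀ h → stepProduct 1ℤ (suc h) * stepProduct (+ 2) h ≡ + (suc (2 ℕ.* h) !)
  stepProduct-odds*evens zero    = refl
  stepProduct-odds*evens (suc h) = begin
    stepProduct 1ℤ (suc h) * (1ℤ + + 2 * + suc h) * (stepProduct (+ 2) h * (+ 2 + + 2 * + h))
      ≡⟨ lemma (stepProduct 1ℤ (suc h)) (stepProduct (+ 2) h) (+ h) ⟩
    (1ℤ + + 2 * + suc h) * ((1ℤ + (1ℤ + + 2 * + h)) * (stepProduct 1ℤ (suc h) * stepProduct (+ 2) h))
      ≡⟨ cong₂ (λ b f → (1ℤ + + 2 * + suc h) * ((1ℤ + b) * f)) (sym (pos-suc-2* h)) (stepProduct-odds*evens h) ⟩
    (1ℤ + + 2 * + suc h) * (+ suc (suc (2 ℕ.* h)) * + (suc (2 ℕ.* h) !))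
      ≡⟨ cong₂ _*_ (pos-suc-2* (suc h)) (ℤ.pos-* (suc (suc (2 ℕ.* h))) (suc (2 ℕ.* h) !)) ⟨
    + suc (2 ℕ.* suc h) * + (suc (suc (2 ℕ.* h)) ℕ.* suc (2 ℕ.* h) !)
      ≡⟨ ℤ.pos-* (suc (2 ℕ.* suc h)) (suc (suc (2 ℕ.* h)) ℕ.* suc (2 ℕ.* h) !) ⟨
    + (suc (2 ℕ.* suc h) ℕ.* (suc (suc (2 ℕ.* h)) ℕ.* suc (2 ℕ.* h) !))
      ≡⟨ cong +_ ([2h+3]! h) ⟨
    + (suc (2 ℕ.* suc h) !) ∎
    where
    open ≡-Reasoning
    lemma : ∀ o e h → o * (1ℤ + + 2 * (1ℤ + h)) * (e * (+ 2 + + 2 * h))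
                      ≡ (1ℤ + + 2 * (1ℤ + h)) * ((1ℤ + (1ℤ + + 2 * h)) * (o * e))
    lemma = solve-∀

  -- The factors 2h+2, 2h+4, …, 4h+2 of 2·4⋯(4h+2) = 2ⁿ n! (n = 2h+1) are congruent to −(2h+1), …, −3, −1
  -- modulo 4h+3, and together with 2, 4, …, 2h they make up n! again.
  two-pow-factorial-mod : ∀ h →
    (+ 2) ^ suc (2 ℕ.* h) * + (suc (2 ℕ.* h) !) ≡ (- 1ℤ) ^ suc h * + (suc (2 ℕ.* h) !) mod (4 ℕ.* h ℕ.+ 3)
  two-pow-factorial-mod h = begin
    (+ 2) ^ n * + (n !)                                   ≡⟨ stepProduct-evens n ⟨
    stepProduct (+ 2) n                                   ≡⟨ cong (stepProduct (+ 2)) (n≡h+[1+h] h) ⟩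
    stepProduct (+ 2) (h ℕ.+ suc h)                       ≡⟨ stepProduct-split (+ 2) h (suc h) ⟩
    stepProduct (+ 2) h * stepProduct (+ 2 + + 2 * + h) (suc h)
      ≈⟨ *-congˡ-mod (stepProduct (+ 2) h) (stepProduct-cong-mod (suc h) shift) ⟩
    stepProduct (+ 2) h * stepProduct (+ 2 - (1ℤ + + 2 * + suc h)) (suc h)
      ≡⟨ cong (stepProduct (+ 2) h *_) (stepProduct-reflect 1ℤ (suc h)) ⟩
    stepProduct (+ 2) h * ((- 1ℤ) ^ suc h * stepProduct 1ℤ (suc h))
      ≡⟨ lemma (stepProduct (+ 2) h) ((- 1ℤ) ^ suc h) (stepProduct 1ℤ (suc h)) ⟩
    (- 1ℤ) ^ suc h * (stepProduct 1ℤ (suc h) * stepProduct (+ 2) h)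
      ≡⟨ cong ((- 1ℤ) ^ suc h *_) (stepProduct-odds*evens h) ⟩
    (- 1ℤ) ^ suc h * + (n !)                              ∎
    where
    open ≡-mod-Reasoning (4 ℕ.* h ℕ.+ 3)
    n = suc (2 ℕ.* h)
    n≡h+[1+h] : ∀ h → suc (2 ℕ.* h) ≡ h ℕ.+ suc h
    n≡h+[1+h] = ℕ-solve-∀
    lemma : ∀ e s o → e * (s * o) ≡ s * (o * e)
    lemma = solve-∀
    shift-eq : ∀ h → + 2 + + 2 * h - (+ 2 - (1ℤ + + 2 * (1ℤ + h))) ≡ 1ℤ * (+ 4 * h + + 3)
    shift-eq = solve-∀
    shift : + 2 + + 2 * + h ≡ + 2 - (1ℤ + + 2 * + suc h) mod (4 ℕ.* h ℕ.+ 3)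
    shift = mod-by (divides 1ℤ (trans (shift-eq (+ h))
              (cong (1ℤ *_) (sym (trans (ℤ.pos-+ (4 ℕ.* h) 3) (cong (_+ + 3) (ℤ.pos-* 4 h)))))))

  two-pow-mod : ∀ {p h} → Prime p → p ≡ 4 ℕ.* h ℕ.+ 3 → (+ 2) ^ suc (2 ℕ.* h) ≡ (- 1ℤ) ^ suc h mod p
  two-pow-mod {h = h} pp refl =
    prime-cancelʳ-mod pp (+ (suc (2 ℕ.* h) !)) (prime∤! pp n<p ∘ ≡0-mod⇒∣) (two-pow-factorial-mod h)
    where
    lemma : ∀ h → 4 ℕ.* h ℕ.+ 3 ≡ suc (suc (2 ℕ.* h)) ℕ.+ suc (2 ℕ.* h)
    lemma = ℕ-solve-∀
    n<p : suc (2 ℕ.* h) < 4 ℕ.* h ℕ.+ 3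
    n<p = subst (suc (2 ℕ.* h) <_) (sym (lemma h)) (ℕ.m≤m+n _ _)

module QuadraticResidues where

  open Congruence
  open Arithmetic using (m%n≡r⇒m≡r+[m/n]*n)
  open FermatLittle using (euler-criterion-mod)
  open QuadraticCharacterOfTwo using (two-pow-mod)
  open import Data.Nat as ℕ using (ℕ; zero; suc; _<_; z≤n; s≤s)
  import Data.Nat.Properties as ℕ
  open import Data.Nat.Primality using (Prime)
  open import Data.Integer using (+_; -_; _*_; _^_; 0ℤ; 1ℤ)
  open import Data.Integer.Tactic.RingSolver using (solve-∀)
  open import Data.Nat.Tactic.RingSolver using () renaming (solve-∀ to ℕ-solve-∀)
  open import Relation.Nullary using (¬_)
  open import Relation.Binary.PropositionalEquality

  private
    ^-distribʳ-* : ∀ a b n → (a * b) ^ n ≡ a ^ n * b ^ n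
    ^-distribʳ-* a b zero    = refl
    ^-distribʳ-* a b (suc n) = trans (cong (a * b *_) (^-distribʳ-* a b n)) (lemma a b (a ^ n) (b ^ n))
      where
      lemma : ∀ a b x y → a * b * (x * y) ≡ a * x * (b * y)
      lemma = solve-∀

  -1-nonresidue : ∀ {p} → Prime p → p ℕ.% 4 ≡ 3 → ∀ z → ¬ (+ z * + z ≡ - 1ℤ mod p)
  -1-nonresidue {p} pp p%4≡3 z z²≡-1 = -1≢1-mod 2<p (begin
    - 1ℤ                     ≈⟨ ^-odd-mod ≡-mod-refl h ⟨
    (- 1ℤ) ^ suc (2 ℕ.* h)   ≈⟨ euler-criterion-mod pp p≡1+2[1+2h] z z²≡-1 -1≢0 ⟩
    1ℤ                       ∎)
    where
    open ≡-mod-Reasoning p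
    h = p ℕ./ 4
    lemma : ∀ h → 3 ℕ.+ h ℕ.* 4 ≡ suc (2 ℕ.* suc (2 ℕ.* h))
    lemma = ℕ-solve-∀
    p≡1+2[1+2h] : p ≡ suc (2 ℕ.* suc (2 ℕ.* h))
    p≡1+2[1+2h] = trans (m%n≡r⇒m≡r+[m/n]*n p%4≡3) (lemma h)
    2<p : 2 < p
    2<p = subst (2 <_) (sym (m%n≡r⇒m≡r+[m/n]*n p%4≡3)) (ℕ.m≤m+n 3 _)
    -1≢0 : ¬ (- 1ℤ ≡ 0ℤ mod p)
    -1≢0 = ≢0-mod (- 1ℤ) (s≤s z≤n) (ℕ.<-trans (s≤s (s≤s z≤n)) 2<p)

  -2-nonresidue : ∀ {p} → Prime p → p ℕ.% 8 ≡ 7 → ∀ z → ¬ (+ z * + z ≡ - + 2 mod p)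
  -2-nonresidue {p} pp p%8≡7 z z²≡-2 = -1≢1-mod 2<p (begin
    - 1ℤ                                  ≈⟨ *-cong-mod (^-odd-mod ≡-mod-refl h) (^-even-mod ≡-mod-refl (suc u)) ⟨
    (- 1ℤ) ^ n * (- 1ℤ) ^ (2 ℕ.* suc u)   ≡⟨ cong (λ e → (- 1ℤ) ^ n * (- 1ℤ) ^ e) (1+h≡2[1+u] u) ⟨
    (- 1ℤ) ^ n * (- 1ℤ) ^ suc h           ≈⟨ *-congˡ-mod ((- 1ℤ) ^ n) (two-pow-mod pp p≡4h+3) ⟨
    (- 1ℤ) ^ n * (+ 2) ^ n                ≡⟨ ^-distribʳ-* (- 1ℤ) (+ 2) n ⟨
    (- + 2) ^ n                           ≈⟨ euler-criterion-mod pp p≡1+2n z z²≡-2 -2≢0 ⟩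
    1ℤ                                    ∎)
    where
    open ≡-mod-Reasoning p
    u = p ℕ./ 8
    h = suc (2 ℕ.* u)
    n = suc (2 ℕ.* h)
    p≡7+8u : p ≡ 7 ℕ.+ u ℕ.* 8
    p≡7+8u = m%n≡r⇒m≡r+[m/n]*n p%8≡7
    lemma₁ : ∀ u → 7 ℕ.+ u ℕ.* 8 ≡ 4 ℕ.* suc (2 ℕ.* u) ℕ.+ 3
    lemma₁ = ℕ-solve-∀
    lemma₂ : ∀ u → 7 ℕ.+ u ℕ.* 8 ≡ suc (2 ℕ.* suc (2 ℕ.* suc (2 ℕ.* u)))
    lemma₂ = ℕ-solve-∀
    1+h≡2[1+u] : ∀ u → suc (suc (2 ℕ.* u)) ≡ 2 ℕ.* suc u
    1+h≡2[1+u] = ℕ-solve-∀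
    p≡4h+3 : p ≡ 4 ℕ.* h ℕ.+ 3
    p≡4h+3 = trans p≡7+8u (lemma₁ u)
    p≡1+2n : p ≡ suc (2 ℕ.* n)
    p≡1+2n = trans p≡7+8u (lemma₂ u)
    2<p : 2 < p
    2<p = subst (2 <_) (sym p≡7+8u) (ℕ.m≤m+n 3 _)
    -2≢0 : ¬ (- + 2 ≡ 0ℤ mod p)
    -2≢0 = ≢0-mod (- + 2) (s≤s z≤n) 2<p

module PowersOfThree where

  open Congruence
  open Parity
  open Arithmetic using (prime-∣-^; prime[3]; prime[13])
  open import Data.Nat
  open import Data.Nat.Properties
  open import Data.Nat.Divisibility
  open import Data.Nat.DivMod using (m≡m%n+[m/n]*n; m%n<n)
  open import Data.Nat.Primality using (euclidsLemma; prime⇒irreducible)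
  open import Data.Nat.Tactic.RingSolver using (solve-∀)
  open import Data.Integer as ℤ using (+_; 0ℤ; 1ℤ)
  import Data.Integer.Properties as ℤ
  open import Data.Product using (_×_; _,_)
  open import Data.Sum using (inj₁; inj₂; [_,_]′)
  open import Data.Empty using (⊥-elim)
  open import Function using (_∘_)
  open import Relation.Binary.Definitions using (tri<; tri≈; tri>)
  open import Relation.Nullary using (¬_; contradiction)
  open import Relation.Nullary.Decidable using (toWitnessFalse)
  open import Relation.Binary.PropositionalEquality

  ^-mod-period : ∀ {n m} b a .{{_ : NonZero m}} → b ℤ.^ m ≡ 1ℤ mod n → b ℤ.^ a ≡ b ℤ.^ (a % m) mod n
  ^-mod-period {n} {m} b a bᵐ≡1 = begin
    b ℤ.^ a                                  ≡⟨ cong (b ℤ.^_) (m≡m%n+[m/n]*n a m) ⟩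
    b ℤ.^ (a % m + a / m * m)                ≡⟨ ℤ.^-distribˡ-+-* b (a % m) (a / m * m) ⟩
    b ℤ.^ (a % m) ℤ.* b ℤ.^ (a / m * m)      ≡⟨ cong (λ e → b ℤ.^ (a % m) ℤ.* b ℤ.^ e) (*-comm (a / m) m) ⟩
    b ℤ.^ (a % m) ℤ.* b ℤ.^ (m * (a / m))    ≡⟨ cong (b ℤ.^ (a % m) ℤ.*_) (ℤ.^-*-assoc b m (a / m)) ⟨
    b ℤ.^ (a % m) ℤ.* (b ℤ.^ m) ℤ.^ (a / m)  ≈⟨ *-congˡ-mod (b ℤ.^ (a % m)) (^-cong-mod (a / m) bᵐ≡1) ⟩
    b ℤ.^ (a % m) ℤ.* 1ℤ ℤ.^ (a / m)         ≡⟨ cong (b ℤ.^ (a % m) ℤ.*_) (ℤ.^-zeroˡ (a / m)) ⟩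
    b ℤ.^ (a % m) ℤ.* 1ℤ                     ≡⟨ ℤ.*-identityʳ _ ⟩
    b ℤ.^ (a % m)                            ∎
    where open ≡-mod-Reasoning n

  -- 3 has order 6 modulo 7, and 3⁶ ≡ 1 modulo 13 as well.
  three-pow-mod-7⇒13 : ∀ a → (+ 3) ℤ.^ a ≡ 1ℤ mod 7 → (+ 3) ℤ.^ a ≡ 1ℤ mod 13
  three-pow-mod-7⇒13 a 3ᵃ≡1 = check (a % 6) (m%n<n a 6)
    (≡-mod-trans (≡-mod-sym (^-mod-period (+ 3) a decide-mod)) 3ᵃ≡1)
    (^-mod-period (+ 3) a decide-mod)
    where
    check : ∀ ρ → ρ < 6 → (+ 3) ℤ.^ ρ ≡ 1ℤ mod 7 →
            (+ 3) ℤ.^ a ≡ (+ 3) ℤ.^ ρ mod 13 → (+ 3) ℤ.^ a ≡ 1ℤ mod 13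
    check 0 _ _  e = e
    check 1 _ e₇ _ = ⊥-elim (refute-mod e₇)
    check 2 _ e₇ _ = ⊥-elim (refute-mod e₇)
    check 3 _ e₇ _ = ⊥-elim (refute-mod e₇)
    check 4 _ e₇ _ = ⊥-elim (refute-mod e₇)
    check 5 _ e₇ _ = ⊥-elim (refute-mod e₇)
    check (suc (suc (suc (suc (suc (suc _)))))) (s≤s (s≤s (s≤s (s≤s (s≤s (s≤s ())))))) _ _

  3ᵃ≡9⇒a≡2 : ∀ {a} → 3 ^ a ≡ 9 → a ≡ 2
  3ᵃ≡9⇒a≡2 {a} 3ᵃ≡9 with <-cmp a 2
  ... | tri< a<2 _ _ = contradiction 3ᵃ≡9 (<⇒≢ (^-monoʳ-< 3 (s≤s (s≤s z≤n)) a<2))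
  ... | tri≈ _ a≡2 _ = a≡2
  ... | tri> _ _ a>2 = contradiction (sym 3ᵃ≡9) (<⇒≢ (^-monoʳ-< 3 (s≤s (s≤s z≤n)) a>2))

  3ᵃ≢345 : ∀ a → 3 ^ a ≢ 345
  3ᵃ≢345 0 ()
  3ᵃ≢345 1 ()
  3ᵃ≢345 (suc (suc a)) 3ᵃ≡345 =
    toWitnessFalse {a? = 9 ∣? 345} _ (divides (3 ^ a) (trans (sym 3ᵃ≡345) (lemma (3 ^ a))))
    where
    lemma : ∀ x → 3 * (3 * x) ≡ x * 9
    lemma = solve-∀

  three-seven-solution : ∀ {a k y} → 3 ^ a ≡ 7 ^ y + 2 → k * y ≡ 3 → k ≡ 3 × y ≡ 1 × a ≡ 2
  three-seven-solution {a} {k} {y} eq ky≡3 with prime⇒irreducible prime[3] (divides k (sym ky≡3))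
  ... | inj₁ refl = trans (sym (*-identityʳ k)) ky≡3 , refl , 3ᵃ≡9⇒a≡2 eq
  ... | inj₂ refl = contradiction eq (3ᵃ≢345 a)

  three-seven-solutions : ∀ {a j k y} → 3 ^ suc a ≡ 7 ^ y + 2 ^ j → k * y ≡ 2 + j → k ≡ 3 × y ≡ 1 × suc a ≡ 2
  three-seven-solutions {a} {j} {k} {y} eq ky≡2+j with evenOdd j
  ... | even m = ⊥-elim (refute-mod (begin
    0ℤ                                     ≈⟨ ^-suc≡0-mod 3 a ⟨
    (+ 3) ℤ.^ suc a                        ≡⟨ pos-^≡^+^ 3 (suc a) 7 y 2 (2 * m) eq ⟩
    (+ 7) ℤ.^ y ℤ.+ (+ 2) ℤ.^ (2 * m)
      ≈⟨ +-cong-mod (^-cong-mod {a = + 7} y decide-mod) (^-even-mod {a = + 2} decide-mod m) ⟩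
    1ℤ ℤ.^ y ℤ.+ 1ℤ                        ≡⟨ cong (ℤ._+ 1ℤ) (ℤ.^-zeroˡ y) ⟩
    + 2                                    ∎))
    where open ≡-mod-Reasoning 3
  ... | odd zero = three-seven-solution eq ky≡2+j
  ... | odd (suc m) with evenOdd y
  ...   | even n = ⊥-elim (even≢odd (k * n) (suc (suc m)) (trans (lemma k n) (trans ky≡2+j (lemma′ m))))
    where
    lemma : ∀ k n → 2 * (k * n) ≡ k * (2 * n)
    lemma = solve-∀
    lemma′ : ∀ m → 2 + suc (2 * suc m) ≡ suc (2 * suc (suc m))
    lemma′ = solve-∀
  ...   | odd n = ⊥-elim (parity-of-a (evenOdd (suc a)) (begin
    (+ 3) ℤ.^ suc a                                 ≡⟨ pos-^≡^+^ 3 (suc a) 7 (suc (2 * n)) 2 (suc (2 * suc m)) eq ⟩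
    (+ 7) ℤ.^ suc (2 * n) ℤ.+ (+ 2) ℤ.^ suc (2 * suc m)
      ≈⟨ +-cong-mod (^-odd-mod {a = + 7} decide-mod n)
                    (subst (λ e → (+ 2) ℤ.^ e ≡ 0ℤ mod 8) (lemma m) (two-pow-≡0-mod 3 (2 * m))) ⟩
    + 7 ℤ.+ 0ℤ                                      ∎))
    where
    open ≡-mod-Reasoning 8
    lemma : ∀ m → 3 + 2 * m ≡ suc (2 * suc m)
    lemma = solve-∀
    parity-of-a : ∀ {A} → EvenOdd A → ¬ ((+ 3) ℤ.^ A ≡ + 7 mod 8)
    parity-of-a (even b) 3ᴬ≡7 = refute-mod (≡-mod-trans (≡-mod-sym (^-even-mod {a = + 3} decide-mod b)) 3ᴬ≡7)
    parity-of-a (odd b)  3ᴬ≡7 = refute-mod (≡-mod-trans (≡-mod-sym (^-odd-mod {a = + 3} decide-mod b)) 3ᴬ≡7)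

  3ᵃ≢1+2ʲ7ʸ⁺¹ : ∀ a j y → 3 ^ a ≢ 1 + 2 ^ j * 7 ^ suc y
  3ᵃ≢1+2ʲ7ʸ⁺¹ a j y eq =
    [ 13∤2ʲ , 13∤7ʸ⁺¹ ]′ (euclidsLemma (2 ^ j) (7 ^ suc y) prime[13] (≡0-mod⇒∣ X≡0-mod-13))
    where
    X = 2 ^ j * 7 ^ suc y
    3ᵃ≡1+X : (+ 3) ℤ.^ a ≡ 1ℤ ℤ.+ + X
    3ᵃ≡1+X = trans (sym (pos-^ 3 a)) (cong +_ eq)
    X≡0-mod-7 : + X ≡ 0ℤ mod 7
    X≡0-mod-7 = ≡+multiple⇒≡-mod (2 ^ j * 7 ^ y) (lemma (2 ^ j) (7 ^ y))
      where
      lemma : ∀ a b → a * (7 * b) ≡ 0 + a * b * 7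
      lemma = solve-∀
    3ᵃ≡1-mod-7 : (+ 3) ℤ.^ a ≡ 1ℤ mod 7
    3ᵃ≡1-mod-7 = ≡-mod-trans (≡-mod-reflexive 3ᵃ≡1+X) (+-congˡ-mod 1ℤ X≡0-mod-7)
    X≡0-mod-13 : + X ≡ 0ℤ mod 13
    X≡0-mod-13 =
      +-cancelˡ-mod 1ℤ (≡-mod-trans (≡-mod-reflexive (sym 3ᵃ≡1+X)) (three-pow-mod-7⇒13 a 3ᵃ≡1-mod-7))
    13∤2ʲ : ¬ 13 ∣ 2 ^ j
    13∤2ʲ = toWitnessFalse {a? = 13 ∣? 2} _ ∘ prime-∣-^ j prime[13]
    13∤7ʸ⁺¹ : ¬ 13 ∣ 7 ^ suc y
    13∤7ʸ⁺¹ = toWitnessFalse {a? = 13 ∣? 7} _ ∘ prime-∣-^ (suc y) prime[13]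

open Congruence
open Parity
open Arithmetic
open OddSquareDifference
open QuadraticResidues
open PowersOfThree
open import Data.Nat as ℕ using (ℕ; zero; suc; _<_; _≤_; z≤n; s≤s)
import Data.Nat.Properties as ℕ
open import Data.Nat.DivMod using (m%n<n; m∣n⇒o%n%m≡o%m)
open import Data.Nat.Divisibility as ℕ using (divides)
open import Data.Nat.Coprimality as Coprimality using (prime⇒coprime)
open import Data.Nat.Primality using (Prime; prime⇒nonZero)
open import Data.Integer as ℤ using (+_; _+_; _-_; _*_; _^_; 0ℤ; 1ℤ)
import Data.Integer.Properties as ℤ
open import Data.Integer.Tactic.RingSolver using (solve-∀)
open import Data.Nat.Tactic.RingSolver using () renaming (solve-∀ to ℕ-solve-∀)
open import Data.Product using (_×_; _,_; proj₁; proj₂)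
open import Data.Sum using (_⊎_; inj₁; inj₂)
open import Data.Empty using (⊥; ⊥-elim)
open import Relation.Nullary using (¬_; contradiction)
open import Relation.Nullary.Decidable using (toWitnessFalse)
open import Relation.Binary.PropositionalEquality

module SophieGermainEquation {p} (p-prime : Prime p) (q-prime : Prime (2 ℕ.* p ℕ.+ 1)) (p%4≡3 : p ℕ.% 4 ≡ 3) where

  q : ℕ
  q = 2 ℕ.* p ℕ.+ 1

  h : ℕ
  h = p ℕ./ 4

  p≡4h+3 : p ≡ 4 ℕ.* h ℕ.+ 3
  p≡4h+3 = trans (m%n≡r⇒m≡r+[m/n]*n p%4≡3) (lemma h)
    where
    lemma : ∀ h → 3 ℕ.+ h ℕ.* 4 ≡ 4 ℕ.* h ℕ.+ 3
    lemma = ℕ-solve-∀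

  p≡1+2[1+2h] : p ≡ suc (2 ℕ.* suc (2 ℕ.* h))
  p≡1+2[1+2h] = trans p≡4h+3 (lemma h)
    where
    lemma : ∀ h → 4 ℕ.* h ℕ.+ 3 ≡ suc (2 ℕ.* suc (2 ℕ.* h))
    lemma = ℕ-solve-∀

  2<p : 2 < p
  2<p = subst (2 <_) (sym p≡4h+3) (ℕ.m≤n+m 3 (4 ℕ.* h))

  p<q : p < q
  p<q = subst (p <_) (lemma p) (ℕ.m≤n+m (suc p) p)
    where
    lemma : ∀ p → p ℕ.+ suc p ≡ 2 ℕ.* p ℕ.+ 1
    lemma = ℕ-solve-∀

  q∤p : ¬ q ℕ.∣ p
  q∤p q∣p = ℕ.<⇒≱ p<q (ℕ.∣⇒≤ {{prime⇒nonZero p-prime}} q∣p)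

  pos-q : + q ≡ + 2 * + p + 1ℤ
  pos-q = trans (ℤ.pos-+ (2 ℕ.* p) 1) (cong (_+ 1ℤ) (ℤ.pos-* 2 p))

  p≡3-mod-4 : + p ≡ + 3 mod 4
  p≡3-mod-4 = %⇒≡-mod p%4≡3

  q≡3-mod-4 : + q ≡ + 3 mod 4
  q≡3-mod-4 = begin
    + q              ≡⟨ pos-q ⟩
    + 2 * + p + 1ℤ   ≈⟨ +-congʳ-mod 1ℤ (*-congˡ-mod (+ 2) p≡3-mod-4) ⟩
    + 7              ≈⟨ decide-mod ⟩
    + 3              ∎
    where open ≡-mod-Reasoning 4

  q≡1-mod-p : + q ≡ 1ℤ mod p
  q≡1-mod-p = begin
    + q              ≡⟨ pos-q ⟩
    + 2 * + p + 1ℤ   ≈⟨ +-congʳ-mod 1ℤ (*-congˡ-mod (+ 2) (n≡0-mod p)) ⟩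
    1ℤ               ∎
    where open ≡-mod-Reasoning p

  p²≡1-mod-8 : + p * + p ≡ 1ℤ mod 8
  p²≡1-mod-8 = subst (λ n → + n * + n ≡ 1ℤ mod 8) (sym p≡1+2[1+2h]) (odd-square-mod (suc (2 ℕ.* h)))

  p≡3⊎p≡2-mod-3 : p ≡ 3 ⊎ (+ p ≡ + 2 mod 3)
  p≡3⊎p≡2-mod-3 = cases (p ℕ.% 3) (m%n<n p 3) refl
    where
    cases : ∀ ρ → ρ < 3 → p ℕ.% 3 ≡ ρ → p ≡ 3 ⊎ (+ p ≡ + 2 mod 3)
    cases 0 _ p%3≡0 = inj₁ (sym (prime-∣-prime prime[3] p-prime (ℕ.m%n≡0⇒n∣m p 3 p%3≡0)))
    cases 1 _ p%3≡1 = contradiction (prime-∣-prime prime[3] q-prime (≡0-mod⇒∣ q≡0-mod-3)) (ℕ.<⇒≢ 3<q)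
      where
      open ≡-mod-Reasoning 3
      3<q : 3 < q
      3<q = ℕ.≤-<-trans 2<p p<q
      q≡0-mod-3 : + q ≡ 0ℤ mod 3
      q≡0-mod-3 = begin
        + q              ≡⟨ pos-q ⟩
        + 2 * + p + 1ℤ   ≈⟨ +-congʳ-mod 1ℤ (*-congˡ-mod (+ 2) (%⇒≡-mod {p} p%3≡1)) ⟩
        + 3              ≈⟨ n≡0-mod 3 ⟩
        0ℤ               ∎
    cases 2 _ p%3≡2 = inj₂ (%⇒≡-mod {p} p%3≡2)
    cases (suc (suc (suc _))) (s≤s (s≤s (s≤s ()))) _

  p%8≡3⊎p%8≡7 : p ℕ.% 8 ≡ 3 ⊎ p ℕ.% 8 ≡ 7
  p%8≡3⊎p%8≡7 = cases (p ℕ.% 8) (m%n<n p 8) refl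
    (trans (m∣n⇒o%n%m≡o%m 4 8 p (divides 2 refl)) p%4≡3)
    where
    cases : ∀ ρ → ρ < 8 → p ℕ.% 8 ≡ ρ → ρ ℕ.% 4 ≡ 3 → p ℕ.% 8 ≡ 3 ⊎ p ℕ.% 8 ≡ 7
    cases 3 _ e _ = inj₁ e
    cases 7 _ e _ = inj₂ e
    cases (suc (suc (suc (suc (suc (suc (suc (suc _)))))))) (s≤s (s≤s (s≤s (s≤s (s≤s (s≤s (s≤s (s≤s ())))))))) _ _

  pos-2ᵏq : ∀ k → + (2 ℕ.^ k ℕ.* q) ≡ (+ 2) ^ k * + q
  pos-2ᵏq k = trans (ℤ.pos-* (2 ℕ.^ k) q) (cong (_* + q) (pos-^ 2 k))

  pos-equation : ∀ k x y z → p ℕ.^ x ≡ z ℕ.* z ℕ.+ (2 ℕ.^ k ℕ.* q) ℕ.^ y →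
                 (+ p) ^ x ≡ + z * + z + ((+ 2) ^ k * + q) ^ y
  pos-equation k x y z eq = begin
    (+ p) ^ x                                           ≡⟨ pos-^ p x ⟨
    + (p ℕ.^ x)                                         ≡⟨ cong +_ eq ⟩
    + (z ℕ.* z ℕ.+ (2 ℕ.^ k ℕ.* q) ℕ.^ y)               ≡⟨ ℤ.pos-+ (z ℕ.* z) _ ⟩
    + (z ℕ.* z) + + ((2 ℕ.^ k ℕ.* q) ℕ.^ y)             ≡⟨ cong₂ _+_ (ℤ.pos-* z z) (pos-^ (2 ℕ.^ k ℕ.* q) y) ⟩
    + z * + z + (+ (2 ℕ.^ k ℕ.* q)) ^ y                 ≡⟨ cong (λ b → + z * + z + b ^ y) (pos-2ᵏq k) ⟩
    + z * + z + ((+ 2) ^ k * + q) ^ y                   ∎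
    where open ≡-Reasoning

  ¬solution-with-term≡1 : ∀ x z N → (+ p) ^ suc x ≡ + z * + z + N → ¬ (N ≡ 1ℤ mod p)
  ¬solution-with-term≡1 x z N eq N≡1 = -1-nonresidue p-prime p%4≡3 z (+≡0⇒≡neg-mod (+ z * + z) 1ℤ (begin
    + z * + z + 1ℤ    ≈⟨ +-congˡ-mod (+ z * + z) N≡1 ⟨
    + z * + z + N     ≡⟨ eq ⟨
    (+ p) ^ suc x     ≈⟨ ^-suc≡0-mod p x ⟩
    0ℤ                ∎))
    where open ≡-mod-Reasoning p

  ¬solution-with-even-z : ∀ k x y t → ¬ ((+ p) ^ x ≡ + (2 ℕ.* t) * + (2 ℕ.* t) + ((+ 2) ^ suc k * + q) ^ suc y)
  ¬solution-with-even-z k x y t eq = refute-mod (begin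
    1ℤ                                                       ≡⟨ ℤ.^-zeroˡ x ⟨
    1ℤ ^ x                                                   ≈⟨ ^-cong-mod x p≡1-mod-2 ⟨
    (+ p) ^ x                                                ≡⟨ eq ⟩
    + (2 ℕ.* t) * + (2 ℕ.* t) + ((+ 2) ^ suc k * + q) ^ suc y
      ≈⟨ +-cong-mod (*-cong-mod 2t≡0 2t≡0) (^-cong-mod (suc y) 2ᵏ⁺¹q≡0) ⟩
    0ℤ                                                       ∎)
    where
    open ≡-mod-Reasoning 2
    p≡1-mod-2 : + p ≡ 1ℤ mod 2
    p≡1-mod-2 = ≡-mod-trans (≡-mod-weaken (divides 2 refl) p≡3-mod-4) decide-mod
    2t≡0 : + (2 ℕ.* t) ≡ 0ℤ mod 2
    2t≡0 = ≡+multiple⇒≡-mod t (ℕ.*-comm 2 t)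
    2ᵏ⁺¹q≡0 : (+ 2) ^ suc k * + q ≡ 0ℤ mod 2
    2ᵏ⁺¹q≡0 = subst (_≡ 0ℤ mod 2) (lemma ((+ 2) ^ k) (+ q)) (multiple≡0-mod ((+ 2) ^ k * + q))
      where
      lemma : ∀ a b → a * b * + 2 ≡ + 2 * a * b
      lemma = solve-∀

  ¬solution-with-term≡2q : ∀ X z → + z * + z ≡ 1ℤ mod 8 → ¬ ((+ p) ^ X ≡ + z * + z + + 2 * + q)
  ¬solution-with-term≡2q X z z²≡1 eq with evenOdd X
  ... | even a = refute-mod (begin
    1ℤ                     ≈⟨ ^-even-mod (≡-mod-weaken (divides 2 refl) p²≡1-mod-8) a ⟨
    (+ p) ^ (2 ℕ.* a)      ≡⟨ eq ⟩
    + z * + z + + 2 * + q  ≈⟨ +-cong-mod (≡-mod-weaken (divides 2 refl) z²≡1) (*-congˡ-mod (+ 2) q≡3-mod-4) ⟩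
    + 7                    ∎)
    where open ≡-mod-Reasoning 4
  ... | odd a with p%8≡3⊎p%8≡7
  ...   | inj₁ p%8≡3 = refute-mod (begin
    + 3                               ≈⟨ %⇒≡-mod {p} p%8≡3 ⟨
    + p                               ≈⟨ ^-odd-mod p²≡1-mod-8 a ⟨
    (+ p) ^ suc (2 ℕ.* a)             ≡⟨ eq ⟩
    + z * + z + + 2 * + q             ≡⟨ cong (λ b → + z * + z + + 2 * b) pos-q ⟩
    + z * + z + + 2 * (+ 2 * + p + 1ℤ)
      ≈⟨ +-cong-mod z²≡1 (*-congˡ-mod (+ 2) (+-congʳ-mod 1ℤ (*-congˡ-mod (+ 2) (%⇒≡-mod {p} p%8≡3)))) ⟩
    + 15                              ∎)
    where open ≡-mod-Reasoning 8
  ...   | inj₂ p%8≡7 = -2-nonresidue p-prime p%8≡7 z (+≡0⇒≡neg-mod (+ z * + z) (+ 2) (begin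
    + z * + z + + 2         ≡⟨ cong (_+_ (+ z * + z)) (ℤ.*-identityʳ (+ 2)) ⟨
    + z * + z + + 2 * 1ℤ    ≈⟨ +-congˡ-mod (+ z * + z) (*-congˡ-mod (+ 2) q≡1-mod-p) ⟨
    + z * + z + + 2 * + q   ≡⟨ eq ⟨
    (+ p) ^ suc (2 ℕ.* a)   ≈⟨ ^-suc≡0-mod p (2 ℕ.* a) ⟩
    0ℤ                      ∎))
    where open ≡-mod-Reasoning p

  -- r = (p − 1)/2 is odd, smaller than q and divides pᵃ − 1 = 2ʲqʸ⁺¹, so r = 1 and p = 3.
  pᵃ≢1+2ʲqʸ⁺¹ : ∀ a j y → p ℕ.^ a ≢ 1 ℕ.+ 2 ℕ.^ j ℕ.* q ℕ.^ suc y
  pᵃ≢1+2ʲqʸ⁺¹ a j y eq =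
    3ᵃ≢1+2ʲ7ʸ⁺¹ a j y (subst (λ p → p ℕ.^ a ≡ 1 ℕ.+ 2 ℕ.^ j ℕ.* (2 ℕ.* p ℕ.+ 1) ℕ.^ suc y) p≡3 eq)
    where
    r = suc (2 ℕ.* h)
    X = 2 ℕ.^ j ℕ.* q ℕ.^ suc y
    r<q : r < q
    r<q = ℕ.<-trans (subst (r <_) (sym p≡1+2[1+2h]) (s≤s (ℕ.m≤n*m r 2))) p<q
    X≡0-mod-r : + X ≡ 0ℤ mod r
    X≡0-mod-r = +-cancelˡ-mod 1ℤ (begin
      1ℤ + + X         ≡⟨ cong +_ eq ⟨
      + (p ℕ.^ a)      ≡⟨ pos-^ p a ⟩
      (+ p) ^ a        ≈⟨ ^-cong-mod a (≡+multiple⇒≡-mod 2 p≡1+2[1+2h]) ⟩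
      1ℤ ^ a           ≡⟨ ℤ.^-zeroˡ a ⟩
      1ℤ               ∎)
      where open ≡-mod-Reasoning r
    r∣1 : r ℕ.∣ 1
    r∣1 = coprime-^-cancel (suc y) 1 (Coprimality.sym (prime⇒coprime q-prime r<q))
            (coprime-^-cancel j (q ℕ.^ suc y ℕ.* 1) (odd-coprime-2 h)
              (subst (r ℕ.∣_) (cong (2 ℕ.^ j ℕ.*_) (sym (ℕ.*-identityʳ (q ℕ.^ suc y))))
                     (≡0-mod⇒∣ X≡0-mod-r)))
    p≡3 : p ≡ 3
    p≡3 = trans p≡1+2[1+2h] (cong (λ r → suc (2 ℕ.* r)) (ℕ.∣1⇒≡1 r∣1))

  2ʲ+1≡0-mod-p : ∀ a j y → p ℕ.^ suc a ≡ 2 ℕ.^ j ℕ.+ q ℕ.^ y → (+ 2) ^ j + 1ℤ ≡ 0ℤ mod p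
  2ʲ+1≡0-mod-p a j y eq = begin
    (+ 2) ^ j + 1ℤ          ≡⟨ cong (_+_ ((+ 2) ^ j)) (ℤ.^-zeroˡ y) ⟨
    (+ 2) ^ j + 1ℤ ^ y      ≈⟨ +-congˡ-mod ((+ 2) ^ j) (^-cong-mod y q≡1-mod-p) ⟨
    (+ 2) ^ j + (+ q) ^ y   ≡⟨ pos-^≡^+^ p (suc a) 2 j q y eq ⟨
    (+ p) ^ suc a           ≈⟨ ^-suc≡0-mod p a ⟩
    0ℤ                      ∎
    where open ≡-mod-Reasoning p

  -- For j ≥ 2, reduction modulo 4 gives pᵃ⁺¹ ≡ qʸ, hence also modulo 3, leaving 3 ∣ 2ʲ.
  p≡2-mod-3⇒pᵃ⁺¹≢2ʲ+qʸ : ∀ {a j y} → + p ≡ + 2 mod 3 → p ℕ.^ suc a ≡ 2 ℕ.^ j ℕ.+ q ℕ.^ y → ⊥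
  p≡2-mod-3⇒pᵃ⁺¹≢2ʲ+qʸ {a} {zero} {y} p≡2 eq = ≢0-mod (+ 2) (s≤s z≤n) 2<p (2ʲ+1≡0-mod-p a 0 y eq)
  p≡2-mod-3⇒pᵃ⁺¹≢2ʲ+qʸ {a} {1} {y} p≡2 eq = refute-mod (subst (λ n → + n ≡ + 2 mod 3) p≡3 p≡2)
    where
    p≡3 : p ≡ 3
    p≡3 = prime-∣-prime p-prime prime[3] (≡0-mod⇒∣ (2ʲ+1≡0-mod-p a 1 y eq))
  p≡2-mod-3⇒pᵃ⁺¹≢2ʲ+qʸ {a} {suc (suc j)} {y} p≡2 eq = 3∤2ʲ⁺² (+-cancelˡ-mod ((+ q) ^ y) (begin
    (+ q) ^ y + (+ 2) ^ suc (suc j)  ≡⟨ ℤ.+-comm ((+ q) ^ y) _ ⟩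
    (+ 2) ^ suc (suc j) + (+ q) ^ y  ≡⟨ pos-^≡^+^ p (suc a) 2 (suc (suc j)) q y eq ⟨
    (+ p) ^ suc a
      ≈⟨ ^≡^-mod-4⇒mod-3 (suc a) y p≡3-mod-4 q≡3-mod-4 p≡2 q≡2 pᵃ⁺¹≡qʸ-mod-4 ⟩
    (+ q) ^ y                        ≡⟨ ℤ.+-identityʳ _ ⟨
    (+ q) ^ y + 0ℤ                   ∎))
    where
    open ≡-mod-Reasoning 3
    q≡2 : + q ≡ + 2 mod 3
    q≡2 = ≡-mod-trans (≡-mod-reflexive pos-q) (≡-mod-trans (+-congʳ-mod 1ℤ (*-congˡ-mod (+ 2) p≡2)) decide-mod)
    pᵃ⁺¹≡qʸ-mod-4 : (+ p) ^ suc a ≡ (+ q) ^ y mod 4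
    pᵃ⁺¹≡qʸ-mod-4 = ≡-mod-trans (≡-mod-reflexive (pos-^≡^+^ p (suc a) 2 (suc (suc j)) q y eq))
                      (≡-mod-trans (+-congʳ-mod ((+ q) ^ y) (two-pow-≡0-mod 2 j)) (≡-mod-reflexive (ℤ.+-identityˡ _)))
    3∤2ʲ⁺² : ¬ ((+ 2) ^ suc (suc j) ≡ 0ℤ mod 3)
    3∤2ʲ⁺² 2ʲ⁺²≡0 = toWitnessFalse {a? = 3 ℕ.∣? 2} _ (prime-∣-^ (suc (suc j)) prime[3]
      (subst (λ x → 3 ℕ.∣ ℤ.∣ x ∣) (sym (pos-^ 2 (suc (suc j)))) (≡0-mod⇒∣ 2ʲ⁺²≡0)))

  pᵃ⁺¹≡2ʲ+qʸ-solution : ∀ {a j k y} → p ℕ.^ suc a ≡ 2 ℕ.^ j ℕ.+ q ℕ.^ y → k ℕ.* y ≡ 2 ℕ.+ j →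
                        p ≡ 3 × k ≡ 3 × y ≡ 1 × suc a ≡ 2
  pᵃ⁺¹≡2ʲ+qʸ-solution {a} {j} {k} {y} eq ky≡2+j with p≡3⊎p≡2-mod-3
  ... | inj₁ p≡3 = p≡3 , three-seven-solutions 3ᵃ⁺¹≡7ʸ+2ʲ ky≡2+j
    where
    3ᵃ⁺¹≡7ʸ+2ʲ : 3 ℕ.^ suc a ≡ 7 ℕ.^ y ℕ.+ 2 ℕ.^ j
    3ᵃ⁺¹≡7ʸ+2ʲ = trans (subst (λ p → p ℕ.^ suc a ≡ 2 ℕ.^ j ℕ.+ (2 ℕ.* p ℕ.+ 1) ℕ.^ y) p≡3 eq)
                       (ℕ.+-comm (2 ℕ.^ j) (7 ℕ.^ y))
  ... | inj₂ p≡2 = ⊥-elim (p≡2-mod-3⇒pᵃ⁺¹≢2ʲ+qʸ {a} {j} {y} p≡2 eq)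

  z≡5 : ∀ {a j y z} → p ≡ 3 → a ≡ 1 → j ≡ 1 → y ≡ 1 →
        p ℕ.^ (2 ℕ.* suc a) ≡ z ℕ.* z ℕ.+ 4 ℕ.* (2 ℕ.^ j ℕ.* q ℕ.^ y) → z ≡ 5
  z≡5 {z = z} p≡3 refl refl refl eq = square-injective (ℕ.+-cancelʳ-≡ 56 (z ℕ.* z) 25 (sym 81≡z²+56))
    where
    81≡z²+56 : 81 ≡ z ℕ.* z ℕ.+ 56
    81≡z²+56 = subst (λ p → p ℕ.^ 4 ≡ z ℕ.* z ℕ.+ 4 ℕ.* (2 ℕ.^ 1 ℕ.* (2 ℕ.* p ℕ.+ 1) ℕ.^ 1)) p≡3 eq

  odd-z-solution-4∣term : ∀ {X j k y t} → 0 < X →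
                          p ℕ.^ X ≡ suc (2 ℕ.* t) ℕ.* suc (2 ℕ.* t) ℕ.+ 4 ℕ.* (2 ℕ.^ j ℕ.* q ℕ.^ y) →
                          k ℕ.* y ≡ 2 ℕ.+ j → p ≡ 3 × k ≡ 3 × X ≡ 4 × y ≡ 1 × suc (2 ℕ.* t) ≡ 5
  odd-z-solution-4∣term {X} {j} {k} {y} {t} 0<X eq ky≡2+j with evenOdd X
  ... | odd a = ⊥-elim (refute-mod (begin
    + 3                      ≈⟨ p≡3-mod-4 ⟨
    + p                      ≈⟨ ^-odd-mod (≡-mod-weaken (divides 2 refl) p²≡1-mod-8) a ⟨
    (+ p) ^ suc (2 ℕ.* a)    ≡⟨ pos-^ p (suc (2 ℕ.* a)) ⟨
    + (p ℕ.^ suc (2 ℕ.* a))  ≡⟨ cong +_ eq ⟩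
    + (suc (2 ℕ.* t) ℕ.* suc (2 ℕ.* t) ℕ.+ 4 ℕ.* N)
      ≡⟨ ℤ.pos-+ (suc (2 ℕ.* t) ℕ.* suc (2 ℕ.* t)) (4 ℕ.* N) ⟩
    + (suc (2 ℕ.* t) ℕ.* suc (2 ℕ.* t)) + + (4 ℕ.* N)
      ≈⟨ +-cong-mod z²≡1 (≡+multiple⇒≡-mod N (ℕ.*-comm 4 N)) ⟩
    1ℤ                       ∎))
    where
    open ≡-mod-Reasoning 4
    N = 2 ℕ.^ j ℕ.* q ℕ.^ y
    z²≡1 : + (suc (2 ℕ.* t) ℕ.* suc (2 ℕ.* t)) ≡ 1ℤ mod 4
    z²≡1 = subst (_≡ 1ℤ mod 4) (sym (ℤ.pos-* (suc (2 ℕ.* t)) (suc (2 ℕ.* t))))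
                 (≡-mod-weaken (divides 2 refl) (odd-square-mod t))
  ... | even (suc a) = conclude (odd-square-difference-split {j = j} {y} b t q-prime q∤P (trans P²≡pˣ eq))
    where
    b = proj₁ (odd-^ (suc (2 ℕ.* h)) (suc a))
    P≡1+2b : p ℕ.^ suc a ≡ suc (2 ℕ.* b)
    P≡1+2b = trans (cong (ℕ._^ suc a) p≡1+2[1+2h]) (proj₂ (odd-^ (suc (2 ℕ.* h)) (suc a)))
    P²≡pˣ : suc (2 ℕ.* b) ℕ.* suc (2 ℕ.* b) ≡ p ℕ.^ (2 ℕ.* suc a)
    P²≡pˣ = trans (sym (cong₂ ℕ._*_ P≡1+2b P≡1+2b))
                  (trans (sym (ℕ.^-distribˡ-+-* p (suc a) (suc a)))
                         (cong (λ n → p ℕ.^ (suc a ℕ.+ n)) (sym (ℕ.+-identityʳ (suc a)))))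
    q∤P : ¬ q ℕ.∣ suc (2 ℕ.* b)
    q∤P q∣P = q∤p (prime-∣-^ (suc a) q-prime (subst (q ℕ.∣_) (sym P≡1+2b) q∣P))
    pᵃ⁺¹≢1+2ʲqʸ : ∀ {y} → k ℕ.* y ≡ 2 ℕ.+ j → p ℕ.^ suc a ≢ 1 ℕ.+ 2 ℕ.^ j ℕ.* q ℕ.^ y
    pᵃ⁺¹≢1+2ʲqʸ {zero}  ky≡2+j _ = contradiction (trans (sym (ℕ.*-zeroʳ k)) ky≡2+j) λ ()
    pᵃ⁺¹≢1+2ʲqʸ {suc y} _        = pᵃ≢1+2ʲqʸ⁺¹ (suc a) j y
    conclude : suc (2 ℕ.* b) ≡ 1 ℕ.+ 2 ℕ.^ j ℕ.* q ℕ.^ y ⊎ suc (2 ℕ.* b) ≡ 2 ℕ.^ j ℕ.+ q ℕ.^ y →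
               p ≡ 3 × k ≡ 3 × 2 ℕ.* suc a ≡ 4 × y ≡ 1 × suc (2 ℕ.* t) ≡ 5
    conclude (inj₁ P≡1+2ʲqʸ) = ⊥-elim (pᵃ⁺¹≢1+2ʲqʸ ky≡2+j (trans P≡1+2b P≡1+2ʲqʸ))
    conclude (inj₂ P≡2ʲ+qʸ) with pᵃ⁺¹≡2ʲ+qʸ-solution (trans P≡1+2b P≡2ʲ+qʸ) ky≡2+j
    ... | p≡3 , k≡3 , y≡1 , 1+a≡2 = p≡3 , k≡3 , cong (2 ℕ.*_) 1+a≡2 , y≡1 ,
      z≡5 p≡3 (ℕ.suc-injective 1+a≡2) j≡1 y≡1 eq
      where
      j≡1 : j ≡ 1
      j≡1 = sym (ℕ.+-cancelˡ-≡ 2 1 j (trans (sym (cong₂ ℕ._*_ k≡3 y≡1)) ky≡2+j))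

  odd-z-solution-2≤ky : ∀ {k x y t} → 2 ≤ k ℕ.* y →
                        p ℕ.^ suc x ≡ suc (2 ℕ.* t) ℕ.* suc (2 ℕ.* t) ℕ.+ (2 ℕ.^ k ℕ.* q) ℕ.^ y →
                        p ≡ 3 × k ≡ 3 × suc x ≡ 4 × y ≡ 1 × suc (2 ℕ.* t) ≡ 5
  odd-z-solution-2≤ky {k} {x} {y} {t} 2≤ky eq with ℕ.m≤n⇒∃[o]m+o≡n 2≤ky
  ... | j , 2+j≡ky = odd-z-solution-4∣term {t = t} (s≤s z≤n)
    (trans eq (cong (ℕ._+_ (suc (2 ℕ.* t) ℕ.* suc (2 ℕ.* t))) [2ᵏq]ʸ≡4·2ʲqʸ)) (sym 2+j≡ky)
    where
    lemma : ∀ a b → 2 ℕ.* (2 ℕ.* a) ℕ.* b ≡ 4 ℕ.* (a ℕ.* b)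
    lemma = ℕ-solve-∀
    [2ᵏq]ʸ≡4·2ʲqʸ : (2 ℕ.^ k ℕ.* q) ℕ.^ y ≡ 4 ℕ.* (2 ℕ.^ j ℕ.* q ℕ.^ y)
    [2ᵏq]ʸ≡4·2ʲqʸ = begin
      (2 ℕ.^ k ℕ.* q) ℕ.^ y           ≡⟨ ^-distribʳ-* (2 ℕ.^ k) q y ⟩
      (2 ℕ.^ k) ℕ.^ y ℕ.* q ℕ.^ y     ≡⟨ cong (ℕ._* q ℕ.^ y) (ℕ.^-*-assoc 2 k y) ⟩
      2 ℕ.^ (k ℕ.* y) ℕ.* q ℕ.^ y     ≡⟨ cong (λ e → 2 ℕ.^ e ℕ.* q ℕ.^ y) 2+j≡ky ⟨
      2 ℕ.^ (2 ℕ.+ j) ℕ.* q ℕ.^ y     ≡⟨ lemma (2 ℕ.^ j) (q ℕ.^ y) ⟩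
      4 ℕ.* (2 ℕ.^ j ℕ.* q ℕ.^ y)     ∎
      where open ≡-Reasoning

  odd-z-solution : ∀ k x y t →
                   p ℕ.^ suc x ≡ suc (2 ℕ.* t) ℕ.* suc (2 ℕ.* t) ℕ.+ (2 ℕ.^ suc k ℕ.* q) ℕ.^ suc y →
                   p ≡ 3 × suc k ≡ 3 × suc x ≡ 4 × suc y ≡ 1 × suc (2 ℕ.* t) ≡ 5
  odd-z-solution zero    x zero    t eq = ⊥-elim (¬solution-with-term≡2q (suc x) (suc (2 ℕ.* t)) (odd-square-mod t)
    (trans (pos-equation 1 (suc x) 1 (suc (2 ℕ.* t)) eq)
           (cong (_+_ (+ suc (2 ℕ.* t) * + suc (2 ℕ.* t))) (lemma (+ q)))))
    where
    lemma : ∀ x → (+ 2 * 1ℤ * x) * 1ℤ ≡ + 2 * x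
    lemma = solve-∀
  odd-z-solution zero    x (suc y) t eq = odd-z-solution-2≤ky {t = t} (s≤s (s≤s z≤n)) eq
  odd-z-solution (suc k) x y       t eq =
    odd-z-solution-2≤ky {t = t} (ℕ.≤-trans (s≤s (s≤s z≤n)) (ℕ.m≤m*n (suc (suc k)) (suc y))) eq

  solutions : ∀ k x y z → p ℕ.^ x ≡ z ℕ.* z ℕ.+ (2 ℕ.^ k ℕ.* q) ℕ.^ y →
              (x ≡ 0 × y ≡ 0 × z ≡ 0) ⊎ (p ≡ 3 × k ≡ 3 × x ≡ 4 × y ≡ 1 × z ≡ 5)
  solutions k zero y z eq = inj₁ (refl , 1≡m²+nʸ⇒y≡0×m≡0 y 1<2ᵏq eq)
    where
    1<2ᵏq : 1 < 2 ℕ.^ k ℕ.* q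
    1<2ᵏq = ℕ.≤-trans (ℕ.<⇒≤ (ℕ.<-trans 2<p p<q)) (ℕ.m≤n*m q (2 ℕ.^ k) {{ℕ.m^n≢0 2 k}})
  solutions k (suc x) zero z eq = ⊥-elim (¬solution-with-term≡1 x z 1ℤ (pos-equation k (suc x) 0 z eq) ≡-mod-refl)
  solutions zero (suc x) (suc y) z eq = ⊥-elim (¬solution-with-term≡1 x z _ (pos-equation 0 (suc x) (suc y) z eq)
    (≡-mod-trans (^-cong-mod (suc y) (*-congˡ-mod 1ℤ q≡1-mod-p)) (≡-mod-reflexive (ℤ.^-zeroˡ (suc y)))))
  solutions (suc k) (suc x) (suc y) z eq with evenOdd z
  ... | even t = ⊥-elim (¬solution-with-even-z k (suc x) y t (pos-equation (suc k) (suc x) (suc y) (2 ℕ.* t) eq))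
  ... | odd t  = inj₂ (odd-z-solution k x y t eq)

  difference⇒equation : ∀ k x y z → (+ p) ^ x - ((+ 2) ^ k * + q) ^ y ≡ + z * + z →
                        p ℕ.^ x ≡ z ℕ.* z ℕ.+ (2 ℕ.^ k ℕ.* q) ℕ.^ y
  difference⇒equation k x y z eq = ℤ.+-injective (begin
    + (p ℕ.^ x)                                    ≡⟨ pos-^ p x ⟩
    (+ p) ^ x                                      ≡⟨ lemma ((+ p) ^ x) N ⟩
    (+ p) ^ x - N + N                              ≡⟨ cong (_+ N) eq ⟩
    + z * + z + N
      ≡⟨ cong₂ _+_ (ℤ.pos-* z z) (trans (pos-^ (2 ℕ.^ k ℕ.* q) y) (cong (_^ y) (pos-2ᵏq k))) ⟨
    + (z ℕ.* z) + + ((2 ℕ.^ k ℕ.* q) ℕ.^ y)        ≡⟨ ℤ.pos-+ (z ℕ.* z) _ ⟨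
    + (z ℕ.* z ℕ.+ (2 ℕ.^ k ℕ.* q) ℕ.^ y)          ∎)
    where
    open ≡-Reasoning
    N = ((+ 2) ^ k * + q) ^ y
    lemma : ∀ a b → a ≡ a - b + b
    lemma = solve-∀

open import Defs
open import Data.Nat using (_%_)

theorem4p4 : (p k x y z : ℕ) → SophieGermainPrime p → p % 4 ≡ 3
    → (+ p) ^ x - ((+ 2) ^ k * (+ (2 Data.Nat.* p Data.Nat.+ 1))) ^ y ≡ (+ z) * (+ z)
    → (x ≡ 0 × y ≡ 0 × z ≡ 0) ⊎ (p ≡ 3 × k ≡ 3 × x ≡ 4 × y ≡ 1 × z ≡ 5)
theorem4p4 p k x y z (p-prime , q-prime) p%4≡3 eq = solutions k x y z (difference⇒equation k x y z eq)
  where open SophieGermainEquation p-prime q-prime p%4≡3
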